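{- For every partition $\mu$ and every integer $m\geq0$: (1) $\nu^m(\gamma_\mu)$ is defined; (2) $\mathrm{dinv}(\nu^m(\gamma_\mu))=\binom{\mu_1+\ell(\mu)+1}{2}-|\mu|-\ell(\mu)+m$; (3) with $\zeta=\zeta(\mu)$, the sequence $(\Delta(\nu^1(\gamma_\mu)),\Delta(\nu^2(\gamma_\mu)),\ldots)$ equals $(\underline{(\zeta+2)}^{\zeta+1},\underline{(\zeta+3)}^{\zeta+2},\underline{(\zeta+4)}^{\zeta+3},\ldots)$, i.e. $\zeta+1$ copies of $\zeta+2$, then $\zeta+2$ copies of $\zeta+3$, and so on.
   Context: Partitions are identified up to trailing zeros; $\ell(\gamma)$ is the number of nonzero parts, $|\gamma|$ the sum of parts; the diagram of $\gamma$ is $\{(i,j):1\leq i\leq\ell(\gamma),1\leq j\leq\gamma_i\}$. For a cell $c=(i,j)$, $\mathrm{arm}(c)=\gamma_i-j$, $\mathrm{leg}(c)=\gamma'_j-i$ ($\gamma'$ the conjugate). $\mathrm{dinv}(\gamma)$ is the number of cells with $\mathrm{arm}(c)-\mathrm{leg}(c)\in\{0,1\}$. $\gamma$ is a Dyck partition of order $n$ if its diagram is contained in that of $(n-1,n-2,\ldots,1,0)$; $\Delta(\gamma)$ is the least such $n$. If $\gamma_1\leq\ell(\gamma)+2$, $\nu(\gamma)=(\ell(\gamma)+1,\gamma_1-1,\ldots,\gamma_{\ell(\gamma)}-1)$ (otherwise undefined); $\nu^m$ is the $m$-fold iterate. For a Dyck vector $v=(v_1,\ldots,v_n)$, $\mathrm{dp}_n(v)=(n-1-v_n,n-2-v_{n-1},\ldots,1-v_2,0-v_1)$.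 For a nonzero partition $\mu$, $\zeta(\mu)=\mu_1+\ell(\mu)$, $e_j$ is the number of parts of $\mu$ equal to $j$, and $\gamma_\mu=\mathrm{dp}_{\zeta(\mu)+1}(0,0,\underline{1}^{e_1},0,\underline{1}^{e_2},\ldots,0,\underline{1}^{e_{\mu_1}})$ ($\underline{1}^e$ denotes $e$ ones); for $\mu=(0)$, $\zeta(\mu)=0$ and $\gamma_\mu=(0)$. -}

module Defs where

open import Data.Nat using (ℕ; zero; suc; _+_; _*_; _∸_; _≤_; _<_; _≤ᵇ_; _≡ᵇ_; pred)
open import Data.Bool using (Bool; true; false; if_then_else_; _∧_)
open import Data.Nat.ListAction using (sum)
open import Data.List using (List; []; _∷_; length; map; filter; reverse; replicate; _++_; concatMap; upTo; zipWith)
open import Data.Maybe using (Maybe; just; nothing; _>>=_)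
open import Data.Nat.Properties using (_≤?_)

-- Partitions are lists of naturals (parts in weakly decreasing order).
-- A genuine partition has all parts positive; (0) is the empty list.
IsPartition : List ℕ → Set
IsPartition [] = Data.Unit.⊤ where import Data.Unit
IsPartition (x ∷ []) = 1 ≤ x
IsPartition (x ∷ y ∷ xs) = (y ≤ x) Data.Product.× IsPartition (y ∷ xs) where import Data.Product

-- strip trailing zeros (partitions are identified up to trailing zeros)
consZ : ℕ → List ℕ → List ℕ
consZ zero [] = []
consZ (suc x) [] = suc x ∷ []
consZ x (y ∷ ys) = x ∷ y ∷ ys

strip : List ℕ → List ℕ
strip [] = []
strip (x ∷ xs) = consZ x (strip xs)

-- i-th entry (0-indexed), 0 beyond the end
at : List ℕ → ℕ → ℕ
at [] _ = 0
at (x ∷ xs) zero = x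
at (x ∷ xs) (suc i) = at xs i

len : List ℕ → ℕ
len γ = length (strip γ)

size : List ℕ → ℕ
size γ = sum γ

first : List ℕ → ℕ
first γ = at γ 0

conj : List ℕ → ℕ → ℕ
conj γ j = length (filter (λ x → j ≤? x) γ)

-- arm and leg of cell (i,j), 1-indexed
arm : List ℕ → ℕ → ℕ → ℕ
arm γ i j = at γ (i ∸ 1) ∸ j

leg : List ℕ → ℕ → ℕ → ℕ
leg γ i j = conj γ j ∸ i

dinvCell : List ℕ → ℕ → ℕ → Bool
dinvCell γ i j = (leg γ i j ≤ᵇ arm γ i j) ∧ (arm γ i j ≤ᵇ suc (leg γ i j))

count : List Bool → ℕ
count [] = 0
count (true ∷ bs) = suc (count bs)
count (false ∷ bs) = count bs

dinv : List ℕ → ℕ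
dinv γ0 = sum (map (λ i → count (map (λ j → dinvCell γ (suc i) (suc j)) (upTo (at γ i)))) (upTo (length γ)))
  where γ = strip γ0

-- γ is a Dyck partition of order n: diagram ⊆ diagram of (n-1,...,1,0),
-- i.e. every cell (i,j) (1-indexed) satisfies j ≤ n - i.
DyckOfOrder : List ℕ → ℕ → Set
DyckOfOrder γ n = ∀ i j → 1 ≤ i → i ≤ len γ → 1 ≤ j → j ≤ at γ (i ∸ 1) → i + j ≤ n

IsΔ : List ℕ → ℕ → Set
IsΔ γ n = DyckOfOrder γ n Data.Product.× (∀ m → m < n → DyckOfOrder γ m → Data.Empty.⊥)
  where import Data.Product ; import Data.Empty

ν : List ℕ → Maybe (List ℕ)
ν γ0 = if first γ ≤ᵇ (length γ + 2) then just (strip (suc (length γ) ∷ map pred γ)) else nothing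
  where γ = strip γ0

νIter : ℕ → List ℕ → Maybe (List ℕ)
νIter zero γ = just γ
νIter (suc m) γ = νIter m γ >>= ν

dp : ℕ → List ℕ → List ℕ
dp n v = strip (zipWith (λ i x → (n ∸ suc i) ∸ x) (upTo n) (reverse v))

ζ : List ℕ → ℕ
ζ μ = first μ + len μ

mult : List ℕ → ℕ → ℕ
mult μ j = length (filter (λ x → x Data.Nat.≟ j) μ)

-- the Dyck vector (0,0,1^{e_1},0,1^{e_2},…,0,1^{e_{μ₁}})
γvec : List ℕ → List ℕ
γvec μ = 0 ∷ 0 ∷ replicate (mult μ 1) 1
         ++ concatMap (λ j → 0 ∷ replicate (mult μ j) 1) (map (2 +_) (upTo (first μ ∸ 1)))

γ_ : List ℕ → List ℕ
γ_ [] = []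
γ_ μ@(_ ∷ _) = dp (suc (ζ μ)) (γvec μ)

-- sum of block lengths before block t: Σ_{s<t} (ζ+1+s)
blockStart : ℕ → ℕ → ℕ
blockStart z zero = 0
blockStart z (suc t) = blockStart z t + (suc z + t)

module Submission where

-- If γ is a partition with γ₁ ≤ ℓ(γ)+2 then
--      dinv(ν γ) = dinv γ + 1.  Writing dinv as a double sum over the diagram,
--      peeling the first row of ν γ = (ℓ+1, γ₁-1, …) leaves γ with its first
--      column removed, and the first-row contribution of ν γ exceeds the
--      first-column contribution of γ by exactly one.  Both contributions count
--      "diagonals" (rows i with γ_i + i ∈ {ℓ, ℓ+1}, resp. columns k with
--      γ'_{k+1} + k ∈ {ℓ, ℓ+1}), and these counts agree by a conjugation
--      invariance.  Iterating gives dinv(ν^m γ) = dinv γ + m along any orbit.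
--  (b) Orbit.  Encode a partition by its row reaches R_i = γ_i + i + 1; then ν
--      simply prepends ℓ+2 to R.  For γ_μ the whole orbit is written down
--      explicitly in blocks: block t consists of ζ+1+t states whose reaches are
--      all ≤ ζ+2+t, one of them equal to it.  This shows that ν^m(γ_μ) is always
--      defined and that Δ is constant ζ+2+t on block t.
--  (c) Initial value.  For the Dyck vector g = (0, blockWord μ) of γ_μ,
--      dinv(γ_μ) equals an explicit "weight" of the 0/1 word blockWord μ, and
--      weight + |μ| + ℓ(μ) = C(ζ+1, 2) by induction on μ.

open import Defs
open import Data.Nat using (ℕ; zero; suc; _+_; _*_; _∸_; _≤_; _<_; _≤ᵇ_; _<ᵇ_; _≡ᵇ_; pred; z≤n; s≤s)
open import Data.Nat.Properties
open import Data.Nat.ListAction using (sum)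
open import Data.Nat.Combinatorics using (_C_; nCk+nC[k+1]≡[n+1]C[k+1]; nC1≡n)
open import Data.Nat.Tactic.RingSolver using (solve-∀)
open import Data.Bool using (Bool; true; false; T; if_then_else_; _∧_; _∨_; not)
open import Data.Bool.Properties using (∧-zeroʳ; ∧-identityʳ; ∨-comm)
open import Data.List using (List; []; _∷_; length; map; drop; reverse; replicate; _++_; concatMap; upTo; zipWith; applyUpTo; _∷ʳ_)
open import Data.List.Properties using (++-assoc; ++-identityʳ; map-++; unfold-reverse; length-reverse; length-++; length-map; map-∘; concatMap-++; applyUpTo-∷ʳ)
open import Data.Unit using (⊤; tt)
open import Data.Empty using (⊥; ⊥-elim)
open import Data.Product using (Σ; _×_; _,_; proj₁; proj₂)
open import Data.Sum using (_⊎_; inj₁; inj₂)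
open import Data.Maybe using (just; nothing; _>>=_)
open import Data.Maybe.Properties using (just-injective)
open import Relation.Nullary using (yes; no)
open import Relation.Binary.PropositionalEquality
open import Relation.Binary.Definitions using (tri<; tri≈; tri>)
open import Algebra.Properties.CommutativeSemigroup +-commutativeSemigroup using (interchange)
open import Function using (_∘_)


ind : Bool → ℕ
ind true = 1
ind false = 0

countBelow : (ℕ → Bool) → ℕ → ℕ
countBelow p zero = 0
countBelow p (suc n) = ind (p 0) + countBelow (p ∘ suc) n

sumBelow : (ℕ → ℕ) → ℕ → ℕ
sumBelow f zero = 0
sumBelow f (suc n) = f 0 + sumBelow (f ∘ suc) n

count-map : ∀ (p : ℕ → Bool) f n → count (map p (applyUpTo f n)) ≡ countBelow (p ∘ f) n
count-map p f zero = refl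
count-map p f (suc n) with p (f 0)
... | true = cong suc (count-map p (f ∘ suc) n)
... | false = count-map p (f ∘ suc) n

sum-map : ∀ (g : ℕ → ℕ) f n → sum (map g (applyUpTo f n)) ≡ sumBelow (g ∘ f) n
sum-map g f zero = refl
sum-map g f (suc n) = cong (g (f 0) +_) (sum-map g (f ∘ suc) n)

countBelow-cong : ∀ {p q : ℕ → Bool} n → (∀ i → i < n → p i ≡ q i) → countBelow p n ≡ countBelow q n
countBelow-cong zero h = refl
countBelow-cong (suc n) h = cong₂ _+_ (cong ind (h 0 (s≤s z≤n))) (countBelow-cong n (λ i i<n → h (suc i) (s≤s i<n)))

sumBelow-cong : ∀ {f g : ℕ → ℕ} n → (∀ i → i < n → f i ≡ g i) → sumBelow f n ≡ sumBelow g n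
sumBelow-cong zero h = refl
sumBelow-cong (suc n) h = cong₂ _+_ (h 0 (s≤s z≤n)) (sumBelow-cong n (λ i i<n → h (suc i) (s≤s i<n)))

countBelow-last : ∀ p n → countBelow p (suc n) ≡ countBelow p n + ind (p n)
countBelow-last p zero = +-comm (ind (p 0)) 0
countBelow-last p (suc n) = trans (cong (ind (p 0) +_) (countBelow-last (p ∘ suc) n)) (sym (+-assoc (ind (p 0)) _ _))

sumBelow-last : ∀ f n → sumBelow f (suc n) ≡ sumBelow f n + f n
sumBelow-last f zero = +-comm (f 0) 0
sumBelow-last f (suc n) = trans (cong (f 0 +_) (sumBelow-last (f ∘ suc) n)) (sym (+-assoc (f 0) _ _))

ind-∨ : ∀ a b → ind a + ind b ≡ ind (a ∨ b) + ind (a ∧ b)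
ind-∨ true true = refl
ind-∨ true false = refl
ind-∨ false true = refl
ind-∨ false false = refl

countBelow-∨ : ∀ p q n → countBelow p n + countBelow q n ≡ countBelow (λ i → p i ∨ q i) n + countBelow (λ i → p i ∧ q i) n
countBelow-∨ p q zero = refl
countBelow-∨ p q (suc n) = begin
    (ind (p 0) + countBelow (p ∘ suc) n) + (ind (q 0) + countBelow (q ∘ suc) n)
  ≡⟨ interchange (ind (p 0)) _ (ind (q 0)) _ ⟩
    (ind (p 0) + ind (q 0)) + (countBelow (p ∘ suc) n + countBelow (q ∘ suc) n)
  ≡⟨ cong₂ _+_ (ind-∨ (p 0) (q 0)) (countBelow-∨ (p ∘ suc) (q ∘ suc) n) ⟩
    (ind (p 0 ∨ q 0) + ind (p 0 ∧ q 0)) + (countBelow (λ i → p (suc i) ∨ q (suc i)) n + countBelow (λ i → p (suc i) ∧ q (suc i)) n)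
  ≡⟨ interchange (ind (p 0 ∨ q 0)) _ _ _ ⟩
    (ind (p 0 ∨ q 0) + countBelow (λ i → p (suc i) ∨ q (suc i)) n) + (ind (p 0 ∧ q 0) + countBelow (λ i → p (suc i) ∧ q (suc i)) n) ∎
  where open ≡-Reasoning

ind-if : ∀ c x y → ind (if c then x else y) ≡ ind (c ∧ x) + ind (not c ∧ y)
ind-if true x y = sym (+-identityʳ (ind x))
ind-if false x y = refl

countBelow-if : ∀ (c p q : ℕ → Bool) n → countBelow (λ k → if c k then p k else q k) n ≡ countBelow (λ k → c k ∧ p k) n + countBelow (λ k → not (c k) ∧ q k) n
countBelow-if c p q zero = refl
countBelow-if c p q (suc n) = begin
    ind (if c 0 then p 0 else q 0) + countBelow (λ k → if c (suc k) then p (suc k) else q (suc k)) n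
  ≡⟨ cong₂ _+_ (ind-if (c 0) (p 0) (q 0)) (countBelow-if (c ∘ suc) (p ∘ suc) (q ∘ suc) n) ⟩
    (ind (c 0 ∧ p 0) + ind (not (c 0) ∧ q 0)) + (countBelow (λ k → c (suc k) ∧ p (suc k)) n + countBelow (λ k → not (c (suc k)) ∧ q (suc k)) n)
  ≡⟨ interchange (ind (c 0 ∧ p 0)) _ _ _ ⟩
    (ind (c 0 ∧ p 0) + countBelow (λ k → c (suc k) ∧ p (suc k)) n) + (ind (not (c 0) ∧ q 0) + countBelow (λ k → not (c (suc k)) ∧ q (suc k)) n) ∎
  where open ≡-Reasoning

countBelow-false : ∀ {p : ℕ → Bool} n → (∀ i → i < n → p i ≡ false) → countBelow p n ≡ 0
countBelow-false zero h = refl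
countBelow-false (suc n) h rewrite h 0 (s≤s z≤n) = countBelow-false n (λ i i<n → h (suc i) (s≤s i<n))

countBelow-true : ∀ n → countBelow (λ _ → true) n ≡ n
countBelow-true zero = refl
countBelow-true (suc n) = cong suc (countBelow-true n)

sumBelow-pad : ∀ f k d → (∀ i → k ≤ i → f i ≡ 0) → sumBelow f (k + d) ≡ sumBelow f k
sumBelow-pad f k zero h = cong (sumBelow f) (+-identityʳ k)
sumBelow-pad f k (suc d) h = begin
    sumBelow f (k + suc d)       ≡⟨ cong (sumBelow f) (+-suc k d) ⟩
    sumBelow f (suc (k + d))     ≡⟨ sumBelow-last f (k + d) ⟩
    sumBelow f (k + d) + f (k + d) ≡⟨ cong₂ _+_ (sumBelow-pad f k d h) (h (k + d) (m≤m+n k d)) ⟩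
    sumBelow f k + 0             ≡⟨ +-identityʳ _ ⟩
    sumBelow f k ∎
  where open ≡-Reasoning

sumBelow-trunc : ∀ f k n → k ≤ n → (∀ i → k ≤ i → f i ≡ 0) → sumBelow f n ≡ sumBelow f k
sumBelow-trunc f k n k≤n h = trans (cong (sumBelow f) (sym (m+[n∸m]≡n k≤n))) (sumBelow-pad f k (n ∸ k) h)

T-true : ∀ {b} → T b → b ≡ true
T-true {true} _ = refl

≤ᵇ-suc : ∀ m n → (suc m ≤ᵇ suc n) ≡ (m ≤ᵇ n)
≤ᵇ-suc zero n = refl
≤ᵇ-suc (suc m) n = refl

≤ᵇ-false : ∀ k y → y < k → (k ≤ᵇ y) ≡ false
≤ᵇ-false k y y<k with k ≤ᵇ y in eq
... | false = refl
... | true = ⊥-elim (<⇒≱ y<k (≤ᵇ⇒≤ k y (subst T (sym eq) tt)))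

<ᵇ-false→≤ : ∀ k a → (k <ᵇ a) ≡ false → a ≤ k
<ᵇ-false→≤ k a eq with k <? a
... | no ¬p = ≮⇒≥ ¬p
... | yes p = ⊥-elim (subst T eq (<⇒<ᵇ p))

1≤ᵇ : ∀ a → 1 ≤ a → (1 ≤ᵇ a) ≡ true
1≤ᵇ (suc a) _ = refl

≡ᵇ-refl : ∀ t → (t ≡ᵇ t) ≡ true
≡ᵇ-refl zero = refl
≡ᵇ-refl (suc t) = ≡ᵇ-refl t

≡ᵇ-sym : ∀ x y → (x ≡ᵇ y) ≡ (y ≡ᵇ x)
≡ᵇ-sym zero zero = refl
≡ᵇ-sym zero (suc y) = refl
≡ᵇ-sym (suc x) zero = refl
≡ᵇ-sym (suc x) (suc y) = ≡ᵇ-sym x y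

≡ᵇ-false : ∀ k t → k < t → (k ≡ᵇ t) ≡ false
≡ᵇ-false zero (suc t) h = refl
≡ᵇ-false (suc k) (suc t) (s≤s h) = ≡ᵇ-false k t h

≡ᵇ-+suc : ∀ c s → (c + suc s ≡ᵇ s) ≡ false
≡ᵇ-+suc c s = trans (cong (_≡ᵇ s) (+-comm c (suc s))) (lem s c)
  where
  lem : ∀ s c → (suc s + c ≡ᵇ s) ≡ false
  lem zero c = refl
  lem (suc s) c = lem s c

≡ᵇ-cancelˡ : ∀ j x y → (j + x ≡ᵇ j + y) ≡ (x ≡ᵇ y)
≡ᵇ-cancelˡ zero x y = refl
≡ᵇ-cancelˡ (suc j) x y = ≡ᵇ-cancelˡ j x y

≡ᵇ-disj : ∀ x l → ((x ≡ᵇ l) ∧ (x ≡ᵇ suc l)) ≡ false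
≡ᵇ-disj zero zero = refl
≡ᵇ-disj zero (suc l) = refl
≡ᵇ-disj (suc x) zero = refl
≡ᵇ-disj (suc x) (suc l) = ≡ᵇ-disj x l

ind-≥-suc : ∀ a s → ind (not (suc s <ᵇ a)) ≡ ind (a ≡ᵇ suc s) + ind (not (s <ᵇ a))
ind-≥-suc zero s = refl
ind-≥-suc (suc zero) zero = refl
ind-≥-suc (suc (suc a)) zero = refl
ind-≥-suc (suc a) (suc s) = ind-≥-suc a s

∧-cong-true : ∀ b {c1 c2} → (b ≡ true → c1 ≡ c2) → (b ∧ c1) ≡ (b ∧ c2)
∧-cong-true true h = h refl
∧-cong-true false h = refl

armLegOk : ℕ → ℕ → Bool
armLegOk l a = (l ≤ᵇ a) ∧ (a ≤ᵇ suc l)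

armLegOk-≡ᵇ : ∀ c d → armLegOk c d ≡ ((c ≡ᵇ d) ∨ (suc c ≡ᵇ d))
armLegOk-≡ᵇ zero zero = refl
armLegOk-≡ᵇ zero (suc zero) = refl
armLegOk-≡ᵇ zero (suc (suc d)) = refl
armLegOk-≡ᵇ (suc c) zero = refl
armLegOk-≡ᵇ (suc c) (suc d) = trans (cong₂ _∧_ (≤ᵇ-suc c d) (≤ᵇ-suc d (suc c))) (armLegOk-≡ᵇ c d)

-- The test for cell (1, j+1) of a first row of length l+1 whose column has
-- leg c: it holds iff the "diagonal" c + j + 1 is l or l+1.
row-arith : ∀ c j l → j ≤ l → armLegOk c (l ∸ j) ≡ ((c + suc j ≡ᵇ l) ∨ (c + suc j ≡ᵇ suc l))
row-arith c j l j≤l = begin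
    armLegOk c d
  ≡⟨ armLegOk-≡ᵇ c d ⟩
    (c ≡ᵇ d) ∨ (suc c ≡ᵇ d)
  ≡⟨ ∨-comm (c ≡ᵇ d) _ ⟩
    (suc c ≡ᵇ d) ∨ (c ≡ᵇ d)
  ≡⟨ cong₂ _∨_ (sym (≡ᵇ-cancelˡ j (suc c) d)) (sym (≡ᵇ-cancelˡ j (suc c) (suc d))) ⟩
    (j + suc c ≡ᵇ j + d) ∨ (j + suc c ≡ᵇ j + suc d)
  ≡⟨ cong₂ (λ x y → (x ≡ᵇ j + d) ∨ (x ≡ᵇ y)) e1 (+-suc j d) ⟩
    (c + suc j ≡ᵇ j + d) ∨ (c + suc j ≡ᵇ suc (j + d))
  ≡⟨ cong (λ y → (c + suc j ≡ᵇ y) ∨ (c + suc j ≡ᵇ suc y)) (m+[n∸m]≡n j≤l) ⟩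
    (c + suc j ≡ᵇ l) ∨ (c + suc j ≡ᵇ suc l) ∎
  where
  open ≡-Reasoning
  d = l ∸ j
  e1 : j + suc c ≡ c + suc j
  e1 = trans (+-suc j c) (trans (cong suc (+-comm j c)) (sym (+-suc c j)))

-- The test for cell (i+1, 1) of a row of length a+1 in a diagram with l rows:
-- it holds iff the diagonal a + 1 + i is l or l+1.
col-arith : ∀ a i l → i < l → armLegOk (l ∸ suc i) (suc a ∸ 1) ≡ ((suc a + i ≡ᵇ l) ∨ (suc a + i ≡ᵇ suc l))
col-arith a i l i<l = begin
    armLegOk L a
  ≡⟨ armLegOk-≡ᵇ L a ⟩
    (L ≡ᵇ a) ∨ (suc L ≡ᵇ a)
  ≡⟨ cong₂ _∨_ (≡ᵇ-sym L a) (≡ᵇ-sym (suc L) a) ⟩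
    (a ≡ᵇ L) ∨ (a ≡ᵇ suc L)
  ≡⟨ cong₂ _∨_ (sym (≡ᵇ-cancelˡ (suc i) a L)) (sym (≡ᵇ-cancelˡ (suc i) a (suc L))) ⟩
    (suc i + a ≡ᵇ suc i + L) ∨ (suc i + a ≡ᵇ suc i + suc L)
  ≡⟨ cong₂ (λ x y → (x ≡ᵇ suc i + L) ∨ (x ≡ᵇ y)) e1 (+-suc (suc i) L) ⟩
    (suc a + i ≡ᵇ suc i + L) ∨ (suc a + i ≡ᵇ suc (suc i + L))
  ≡⟨ cong (λ y → (suc a + i ≡ᵇ y) ∨ (suc a + i ≡ᵇ suc y)) (m+[n∸m]≡n i<l) ⟩
    (suc a + i ≡ᵇ l) ∨ (suc a + i ≡ᵇ suc l) ∎
  where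
  open ≡-Reasoning
  L = l ∸ suc i
  e1 : suc i + a ≡ suc a + i
  e1 = cong suc (+-comm i a)

at-consZ : ∀ x s i → at (consZ x s) i ≡ at (x ∷ s) i
at-consZ zero [] zero = refl
at-consZ zero [] (suc i) = refl
at-consZ (suc x) [] i = refl
at-consZ zero (y ∷ s) i = refl
at-consZ (suc x) (y ∷ s) i = refl

at-strip : ∀ l i → at (strip l) i ≡ at l i
at-strip [] i = refl
at-strip (x ∷ l) zero = at-consZ x (strip l) zero
at-strip (x ∷ l) (suc i) = trans (at-consZ x (strip l) (suc i)) (at-strip l i)

at-beyond : ∀ s i → length s ≤ i → at s i ≡ 0
at-beyond [] i h = refl
at-beyond (x ∷ s) (suc i) (s≤s h) = at-beyond s i h

at-beyond-strip : ∀ l i → length (strip l) ≤ i → at l i ≡ 0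
at-beyond-strip l i h = trans (sym (at-strip l i)) (at-beyond (strip l) i h)

at-map : ∀ (f : ℕ → ℕ) l i → i < length l → at (map f l) i ≡ f (at l i)
at-map f (x ∷ l) zero _ = refl
at-map f (x ∷ l) (suc i) (s≤s h) = at-map f l i h

at-map-pred : ∀ l i → at (map pred l) i ≡ pred (at l i)
at-map-pred [] i = refl
at-map-pred (x ∷ l) zero = refl
at-map-pred (x ∷ l) (suc i) = at-map-pred l i

at-++ˡ : ∀ A B i → i < length A → at (A ++ B) i ≡ at A i
at-++ˡ (x ∷ A) B zero _ = refl
at-++ˡ (x ∷ A) B (suc i) (s≤s h) = at-++ˡ A B i h

at-++ʳ : ∀ A B s → at (A ++ B) (length A + s) ≡ at B s
at-++ʳ [] B s = refl
at-++ʳ (x ∷ A) B s = at-++ʳ A B s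

at-map-≤ : ∀ (f : ℕ → ℕ) c l → (∀ j → f j ≤ c) → ∀ i → at (map f l) i ≤ c
at-map-≤ f c [] h i = z≤n
at-map-≤ f c (x ∷ l) h zero = h x
at-map-≤ f c (x ∷ l) h (suc i) = at-map-≤ f c l h i

at-++-≤ : ∀ A B c → (∀ i → at A i ≤ c) → (∀ i → at B i ≤ c) → ∀ i → at (A ++ B) i ≤ c
at-++-≤ [] B c hA hB i = hB i
at-++-≤ (x ∷ A) B c hA hB zero = hA 0
at-++-≤ (x ∷ A) B c hA hB (suc i) = at-++-≤ A B c (λ i → hA (suc i)) hB i

length-consZ : ∀ x s → length (consZ x s) ≤ suc (length s)
length-consZ zero [] = z≤n
length-consZ (suc x) [] = ≤-refl
length-consZ zero (y ∷ s) = ≤-refl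
length-consZ (suc x) (y ∷ s) = ≤-refl

length-strip : ∀ l → length (strip l) ≤ length l
length-strip [] = z≤n
length-strip (x ∷ l) = ≤-trans (length-consZ x (strip l)) (s≤s (length-strip l))

consZ-suc : ∀ x s → consZ (suc x) s ≡ suc x ∷ s
consZ-suc x [] = refl
consZ-suc x (y ∷ s) = refl

strip-consZ : ∀ x s → strip (consZ x s) ≡ consZ x (strip s)
strip-consZ zero [] = refl
strip-consZ (suc x) [] = refl
strip-consZ zero (y ∷ s) = refl
strip-consZ (suc x) (y ∷ s) = refl

strip-idem : ∀ l → strip (strip l) ≡ strip l
strip-idem [] = refl
strip-idem (x ∷ l) = trans (strip-consZ x (strip l)) (cong (consZ x) (strip-idem l))

conj-cons : ∀ x xs j → conj (x ∷ xs) j ≡ ind (j ≤ᵇ x) + conj xs j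
conj-cons x xs j with j ≤ᵇ x
... | true = refl
... | false = refl

conj-consZ : ∀ x s j → conj (consZ x s) (suc j) ≡ conj (x ∷ s) (suc j)
conj-consZ zero [] j = refl
conj-consZ (suc x) [] j = refl
conj-consZ zero (y ∷ s) j = refl
conj-consZ (suc x) (y ∷ s) j = refl

conj-strip : ∀ l j → conj (strip l) (suc j) ≡ conj l (suc j)
conj-strip [] j = refl
conj-strip (x ∷ l) j = begin
    conj (consZ x (strip l)) (suc j)
  ≡⟨ conj-consZ x (strip l) j ⟩
    conj (x ∷ strip l) (suc j)
  ≡⟨ conj-cons x (strip l) (suc j) ⟩
    ind (suc j ≤ᵇ x) + conj (strip l) (suc j)
  ≡⟨ cong (ind (suc j ≤ᵇ x) +_) (conj-strip l j) ⟩
    ind (suc j ≤ᵇ x) + conj l (suc j)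
  ≡⟨ sym (conj-cons x l (suc j)) ⟩
    conj (x ∷ l) (suc j) ∎
  where open ≡-Reasoning

conj-pred : ∀ l j → conj (map pred l) (suc j) ≡ conj l (suc (suc j))
conj-pred [] j = refl
conj-pred (y ∷ ys) j = begin
    conj (pred y ∷ map pred ys) (suc j)
  ≡⟨ conj-cons (pred y) (map pred ys) (suc j) ⟩
    ind (suc j ≤ᵇ pred y) + conj (map pred ys) (suc j)
  ≡⟨ cong₂ _+_ (cong ind (lem y)) (conj-pred ys j) ⟩
    ind (suc (suc j) ≤ᵇ y) + conj ys (suc (suc j))
  ≡⟨ sym (conj-cons y ys (suc (suc j))) ⟩
    conj (y ∷ ys) (suc (suc j)) ∎
  where
  open ≡-Reasoning
  lem : ∀ y → (suc j ≤ᵇ pred y) ≡ (suc (suc j) ≤ᵇ y)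
  lem zero = refl
  lem (suc y) = refl

Desc : List ℕ → Set
Desc [] = ⊤
Desc (x ∷ []) = ⊤
Desc (x ∷ y ∷ l) = (y ≤ x) × Desc (y ∷ l)

Pos : List ℕ → Set
Pos [] = ⊤
Pos (x ∷ l) = (1 ≤ x) × Pos l

Desc-tail : ∀ x l → Desc (x ∷ l) → Desc l
Desc-tail x [] d = tt
Desc-tail x (y ∷ l) (_ , d) = d

Desc-cons : ∀ x l → Desc l → at l 0 ≤ x → Desc (x ∷ l)
Desc-cons x [] d h = tt
Desc-cons x (y ∷ l) d h = h , d

Desc-at : ∀ x l → Desc (x ∷ l) → ∀ i → at l i ≤ x
Desc-at x [] d i = z≤n
Desc-at x (y ∷ l) (y≤x , d) zero = y≤x
Desc-at x (y ∷ l) (y≤x , d) (suc i) = ≤-trans (Desc-at y l d i) y≤x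

Desc-mono : ∀ l → Desc l → ∀ i j → i ≤ j → at l j ≤ at l i
Desc-mono [] d i j h = z≤n
Desc-mono (x ∷ l) d zero zero h = ≤-refl
Desc-mono (x ∷ l) d zero (suc j) h = Desc-at x l d j
Desc-mono (x ∷ l) d (suc i) (suc j) (s≤s h) = Desc-mono l (Desc-tail x l d) i j h

Desc-pred : ∀ l → Desc l → Desc (map pred l)
Desc-pred [] d = tt
Desc-pred (x ∷ []) d = tt
Desc-pred (x ∷ y ∷ l) (y≤x , d) = pred-mono-≤ y≤x , Desc-pred (y ∷ l) d

Desc-strip : ∀ l → Desc l → Desc (strip l) × Pos (strip l)
Desc-strip [] d = tt , tt
Desc-strip (x ∷ l) d with strip l in eq | Desc-strip l (Desc-tail x l d)
... | [] | _ = helper x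
  where
  helper : ∀ x → Desc (consZ x []) × Pos (consZ x [])
  helper zero = tt , tt
  helper (suc x) = tt , (s≤s z≤n , tt)
... | y ∷ s | (ds , (1≤y , ps)) = helper2 x y≤x
  where
  helper2 : ∀ x → y ≤ x → Desc (consZ x (y ∷ s)) × Pos (consZ x (y ∷ s))
  helper2 zero y≤0 with () ← ≤-trans 1≤y y≤0
  helper2 (suc x) y≤x = (y≤x , ds) , (s≤s z≤n , (1≤y , ps))
  y≤x : y ≤ x
  y≤x = subst (_≤ x) (trans (sym (at-strip l 0)) (cong (λ t → at t 0) eq)) (Desc-at x l d 0)

Pos-strip : ∀ l → Pos l → strip l ≡ l
Pos-strip [] p = refl
Pos-strip (x ∷ l) (1≤x , p) rewrite Pos-strip l p = helper x l 1≤x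
  where
  helper : ∀ x l → 1 ≤ x → consZ x l ≡ x ∷ l
  helper (suc x) [] _ = refl
  helper zero (y ∷ l) _ = refl
  helper (suc x) (y ∷ l) _ = refl

Pos-at : ∀ γ → Pos γ → ∀ i → i < length γ → 1 ≤ at γ i
Pos-at (x ∷ γ) (h , p) zero _ = h
Pos-at (x ∷ γ) (h , p) (suc i) (s≤s lt) = Pos-at γ p i lt

IsPartition⇒ : ∀ μ → IsPartition μ → Desc μ × Pos μ
IsPartition⇒ [] _ = tt , tt
IsPartition⇒ (x ∷ []) h = tt , (h , tt)
IsPartition⇒ (x ∷ y ∷ μ) (y≤x , h) with IsPartition⇒ (y ∷ μ) h
... | d , (1≤y , p) = (y≤x , d) , (≤-trans 1≤y y≤x , (1≤y , p))

conj-zero : ∀ a rest k → (∀ i → at rest i ≤ a) → a < k → conj rest k ≡ 0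
conj-zero a [] k h a<k = refl
conj-zero a (y ∷ ys) k h a<k = begin
    conj (y ∷ ys) k ≡⟨ conj-cons y ys k ⟩
    ind (k ≤ᵇ y) + conj ys k ≡⟨ cong₂ _+_ (cong ind (≤ᵇ-false k y (≤-<-trans (h 0) a<k))) (conj-zero a ys k (λ i → h (suc i)) a<k) ⟩
    0 ∎
  where open ≡-Reasoning

conj-Pos : ∀ γ → Pos γ → conj γ 1 ≡ length γ
conj-Pos [] p = refl
conj-Pos (suc x ∷ γ) (_ , p) = trans (conj-cons (suc x) γ 1) (cong suc (conj-Pos γ p))

conj1-strip : ∀ l → Desc l → conj l 1 ≡ length (strip l)
conj1-strip l d = trans (sym (conj-strip l 0)) (conj-Pos (strip l) (proj₂ (Desc-strip l d)))

length-strip-firstZero : ∀ l L → Desc l → (∀ i → i < L → 1 ≤ at l i) → at l L ≡ 0 → length (strip l) ≡ L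
length-strip-firstZero l L d hp h0 with <-cmp (length (strip l)) L
... | tri≈ _ e _ = e
... | tri< lt _ _ = ⊥-elim (<⇒≱ (hp _ lt) (≤-reflexive (at-beyond-strip l (length (strip l)) ≤-refl)))
... | tri> _ _ gt = ⊥-elim (<⇒≱ (Pos-at (strip l) (proj₂ (Desc-strip l d)) L gt) (≤-reflexive (trans (at-strip l L) h0)))

length-strip-lastPositive : ∀ l L → Desc l → 1 ≤ at l L → at l (suc L) ≡ 0 → length (strip l) ≡ suc L
length-strip-lastPositive l L d h1 h0 = length-strip-firstZero l (suc L) d (λ i i<sL → ≤-trans h1 (Desc-mono l d i L (≤-pred i<sL))) h0

rowSums : List ℕ → ℕ → ℕ
rowSums L k = sumBelow (λ i → countBelow (λ j → dinvCell L (suc i) (suc j)) (at L i)) k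

dinvΣ : List ℕ → ℕ
dinvΣ L = rowSums L (length L)

cell-strip : ∀ l i j → dinvCell (strip l) i (suc j) ≡ dinvCell l i (suc j)
cell-strip l i j = cong₂ armLegOk (cong (_∸ i) (conj-strip l j)) (cong (_∸ suc j) (at-strip l (i ∸ 1)))

rowSums-strip : ∀ l k → rowSums (strip l) k ≡ rowSums l k
rowSums-strip l k = sumBelow-cong k (λ i _ → trans (cong (λ n → countBelow (λ j → dinvCell (strip l) (suc i) (suc j)) n) (at-strip l i))
                                                 (countBelow-cong (at l i) (λ j _ → cell-strip l (suc i) j)))

dinv≡dinvΣ : ∀ l → dinv l ≡ dinvΣ l
dinv≡dinvΣ l = begin
    dinv l
  ≡⟨ sum-map _ (λ i → i) (length (strip l)) ⟩
    sumBelow (λ i → count (map (λ j → dinvCell (strip l) (suc i) (suc j)) (upTo (at (strip l) i)))) (length (strip l))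
  ≡⟨ sumBelow-cong (length (strip l)) (λ i _ → count-map (λ j → dinvCell (strip l) (suc i) (suc j)) (λ j → j) (at (strip l) i)) ⟩
    rowSums (strip l) (length (strip l))
  ≡⟨ rowSums-strip l (length (strip l)) ⟩
    rowSums l (length (strip l))
  ≡⟨ sym (sumBelow-trunc _ (length (strip l)) (length l) (length-strip l)
            (λ i h → cong (λ n → countBelow (λ j → dinvCell l (suc i) (suc j)) n) (at-beyond-strip l i h))) ⟩
    dinvΣ l ∎
  where open ≡-Reasoning

dinvΣ-strip : ∀ l → dinvΣ (strip l) ≡ dinvΣ l
dinvΣ-strip l = trans (rowSums-strip l (length (strip l)))
  (sym (sumBelow-trunc _ (length (strip l)) (length l) (length-strip l)
            (λ i h → cong (λ n → countBelow (λ j → dinvCell l (suc i) (suc j)) n) (at-beyond-strip l i h))))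

firstRowCount : List ℕ → ℕ
firstRowCount L = countBelow (λ j → dinvCell L 1 (suc j)) (at L 0)

cell-dropRow : ∀ x xs i j → suc j ≤ x → dinvCell (x ∷ xs) (suc (suc i)) (suc j) ≡ dinvCell xs (suc i) (suc j)
cell-dropRow x xs i j h = cong (λ c → armLegOk (c ∸ suc (suc i)) (at xs i ∸ suc j))
                          (trans (conj-cons x xs (suc j)) (cong (λ b → ind b + conj xs (suc j)) (T-true (≤⇒≤ᵇ h))))

dinv-peelRow : ∀ x xs → Desc (x ∷ xs) → dinvΣ (x ∷ xs) ≡ firstRowCount (x ∷ xs) + dinvΣ xs
dinv-peelRow x xs d = cong (firstRowCount (x ∷ xs) +_)
  (sumBelow-cong (length xs) (λ i _ → countBelow-cong (at xs i) (λ j j<a → cell-dropRow x xs i j (≤-trans j<a (Desc-at x xs d i)))))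

firstColCount : List ℕ → ℕ
firstColCount L = countBelow (λ i → (1 ≤ᵇ at L i) ∧ dinvCell L (suc i) 1) (length L)

firstRowCount-peel : ∀ x xs → firstRowCount (x ∷ xs) ≡ ind ((1 ≤ᵇ x) ∧ dinvCell (x ∷ xs) 1 1) + firstRowCount (pred x ∷ map pred xs)
firstRowCount-peel zero xs = refl
firstRowCount-peel (suc x) xs = cong (ind (dinvCell (suc x ∷ xs) 1 1) +_)
  (countBelow-cong x (λ j _ → cong (λ c → armLegOk (c ∸ 1) (x ∸ suc j)) (sym (conj-pred (suc x ∷ xs) j))))

firstColCount-cons : ∀ x xs → Desc (x ∷ xs) → firstColCount (x ∷ xs) ≡ ind ((1 ≤ᵇ x) ∧ dinvCell (x ∷ xs) 1 1) + firstColCount xs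
firstColCount-cons x xs d = cong (ind ((1 ≤ᵇ x) ∧ dinvCell (x ∷ xs) 1 1) +_) (countBelow-cong (length xs) pt)
  where
  pt : ∀ i → i < length xs → ((1 ≤ᵇ at xs i) ∧ dinvCell (x ∷ xs) (suc (suc i)) 1) ≡ ((1 ≤ᵇ at xs i) ∧ dinvCell xs (suc i) 1)
  pt i _ = ∧-cong-true (1 ≤ᵇ at xs i) (λ e → cell-dropRow x xs i 0 (≤-trans (≤ᵇ⇒≤ 1 (at xs i) (subst T (sym e) tt)) (Desc-at x xs d i)))

dinv-peelColumn : ∀ l → Desc l → dinvΣ l ≡ firstColCount l + dinvΣ (map pred l)
dinv-peelColumn [] d = refl
dinv-peelColumn (x ∷ xs) d = begin
    dinvΣ (x ∷ xs)
  ≡⟨ dinv-peelRow x xs d ⟩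
    firstRowCount (x ∷ xs) + dinvΣ xs
  ≡⟨ cong₂ _+_ (firstRowCount-peel x xs) (dinv-peelColumn xs (Desc-tail x xs d)) ⟩
    (B + firstRowCount (pred x ∷ map pred xs)) + (firstColCount xs + dinvΣ (map pred xs))
  ≡⟨ interchange B _ (firstColCount xs) _ ⟩
    (B + firstColCount xs) + (firstRowCount (pred x ∷ map pred xs) + dinvΣ (map pred xs))
  ≡⟨ cong₂ _+_ (sym (firstColCount-cons x xs d)) (sym (dinv-peelRow (pred x) (map pred xs) (Desc-pred (x ∷ xs) d))) ⟩
    firstColCount (x ∷ xs) + dinvΣ (map pred (x ∷ xs)) ∎
  where
  open ≡-Reasoning
  B = ind ((1 ≤ᵇ x) ∧ dinvCell (x ∷ xs) 1 1)

-- Diagonals.  diagByRows L s = #{ i ≤ s : L_i + i = s } and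
-- diagByCols L s = #{ k ≤ s : L'_{k+1} + k = s }; for a partition they agree,
-- by induction on the first part (the first row contributes to the diagonal
-- s+1 exactly when a = s+1, and shifts all other diagonals by one).

diagByRows : List ℕ → ℕ → ℕ
diagByRows L s = countBelow (λ i → (at L i + i) ≡ᵇ s) (suc s)

diagByCols : List ℕ → ℕ → ℕ
diagByCols L s = countBelow (λ k → (conj L (suc k) + k) ≡ᵇ s) (suc s)

count-atThreshold : ∀ (a t : ℕ) → countBelow (λ k → not (k <ᵇ a) ∧ (k ≡ᵇ t)) (suc t) ≡ ind (not (t <ᵇ a))
count-atThreshold a t = begin
    countBelow (λ k → not (k <ᵇ a) ∧ (k ≡ᵇ t)) (suc t)
  ≡⟨ countBelow-last _ t ⟩
    countBelow (λ k → not (k <ᵇ a) ∧ (k ≡ᵇ t)) t + ind (not (t <ᵇ a) ∧ (t ≡ᵇ t))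
  ≡⟨ cong₂ _+_ (countBelow-false t (λ k k<t → trans (cong (not (k <ᵇ a) ∧_) (≡ᵇ-false k t k<t)) (∧-zeroʳ (not (k <ᵇ a)))))
               (trans (cong (λ b → ind (not (t <ᵇ a) ∧ b)) (≡ᵇ-refl t)) (cong ind (∧-identityʳ (not (t <ᵇ a))))) ⟩
    ind (not (t <ᵇ a)) ∎
  where open ≡-Reasoning

diagByRows-cons : ∀ a rest s → diagByRows (a ∷ rest) (suc s) ≡ ind (a + 0 ≡ᵇ suc s) + diagByRows rest s
diagByRows-cons a rest s = cong (ind (a + 0 ≡ᵇ suc s) +_)
  (countBelow-cong (suc s) (λ i _ → cong (_≡ᵇ suc s) (+-suc (at rest i) i)))

diagByCols-cons : ∀ a rest s → Desc (a ∷ rest) → diagByCols (a ∷ rest) (suc s) ≡ ind (a ≡ᵇ suc s) + diagByCols rest s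
diagByCols-cons a rest s d = begin
    diagByCols (a ∷ rest) (suc s)
  ≡⟨ countBelow-cong (suc (suc s)) (λ k _ → f-pt k) ⟩
    countBelow (λ k → if k <ᵇ a then P k else (k ≡ᵇ suc s)) (suc (suc s))
  ≡⟨ countBelow-if (_<ᵇ a) P (_≡ᵇ suc s) (suc (suc s)) ⟩
    A (suc (suc s)) + countBelow (λ k → not (k <ᵇ a) ∧ (k ≡ᵇ suc s)) (suc (suc s))
  ≡⟨ cong₂ _+_ A-last (count-atThreshold a (suc s)) ⟩
    A (suc s) + ind (not (suc s <ᵇ a))
  ≡⟨ cong (A (suc s) +_) (ind-≥-suc a s) ⟩
    A (suc s) + (ind (a ≡ᵇ suc s) + ind (not (s <ᵇ a)))
  ≡⟨ +-exch0 ⟩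
    ind (a ≡ᵇ suc s) + (A (suc s) + ind (not (s <ᵇ a)))
  ≡⟨ cong (λ x → ind (a ≡ᵇ suc s) + (A (suc s) + x)) (sym (count-atThreshold a s)) ⟩
    ind (a ≡ᵇ suc s) + (A (suc s) + countBelow (λ k → not (k <ᵇ a) ∧ (k ≡ᵇ s)) (suc s))
  ≡⟨ cong (ind (a ≡ᵇ suc s) +_) (sym (countBelow-if (_<ᵇ a) P (_≡ᵇ s) (suc s))) ⟩
    ind (a ≡ᵇ suc s) + countBelow (λ k → if k <ᵇ a then P k else (k ≡ᵇ s)) (suc s)
  ≡⟨ cong (ind (a ≡ᵇ suc s) +_) (countBelow-cong (suc s) (λ k _ → sym (P-pt k))) ⟩
    ind (a ≡ᵇ suc s) + diagByCols rest s ∎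
  where
  open ≡-Reasoning
  hrest : ∀ i → at rest i ≤ a
  hrest = Desc-at a rest d
  P : ℕ → Bool
  P k = (conj rest (suc k) + k) ≡ᵇ s
  A : ℕ → ℕ
  A n = countBelow (λ k → (k <ᵇ a) ∧ P k) n
  +-exch0 : A (suc s) + (ind (a ≡ᵇ suc s) + ind (not (s <ᵇ a))) ≡ ind (a ≡ᵇ suc s) + (A (suc s) + ind (not (s <ᵇ a)))
  +-exch0 = trans (sym (+-assoc (A (suc s)) _ _)) (trans (cong (_+ ind (not (s <ᵇ a))) (+-comm (A (suc s)) _)) (+-assoc (ind (a ≡ᵇ suc s)) (A (suc s)) _))
  A-last : A (suc (suc s)) ≡ A (suc s)
  A-last = trans (countBelow-last (λ k → (k <ᵇ a) ∧ P k) (suc s))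
    (trans (cong (λ b → A (suc s) + ind ((suc s <ᵇ a) ∧ b)) (≡ᵇ-+suc (conj rest (suc (suc s))) s))
      (trans (cong (λ b → A (suc s) + ind b) (∧-zeroʳ (suc s <ᵇ a))) (+-identityʳ _)))
  f-pt : ∀ k → ((conj (a ∷ rest) (suc k) + k) ≡ᵇ suc s) ≡ (if k <ᵇ a then P k else (k ≡ᵇ suc s))
  f-pt k = aux (k <ᵇ a) refl
    where
    aux : ∀ b → (k <ᵇ a) ≡ b → ((conj (a ∷ rest) (suc k) + k) ≡ᵇ suc s) ≡ (if b then P k else (k ≡ᵇ suc s))
    aux true eq = cong (λ c → (c + k) ≡ᵇ suc s) (trans (conj-cons a rest (suc k)) (cong (λ b → ind b + conj rest (suc k)) eq))
    aux false eq = cong (λ c → (c + k) ≡ᵇ suc s)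
      (trans (conj-cons a rest (suc k)) (cong₂ (λ b c → ind b + c) eq (conj-zero a rest (suc k) hrest (s≤s (<ᵇ-false→≤ k a eq)))))
  P-pt : ∀ k → P k ≡ (if k <ᵇ a then P k else (k ≡ᵇ s))
  P-pt k = aux (k <ᵇ a) refl
    where
    aux : ∀ b → (k <ᵇ a) ≡ b → P k ≡ (if b then P k else (k ≡ᵇ s))
    aux true eq = refl
    aux false eq = cong (λ c → (c + k) ≡ᵇ s) (conj-zero a rest (suc k) hrest (s≤s (<ᵇ-false→≤ k a eq)))

diagByRows≡diagByCols : ∀ L → Desc L → ∀ s → diagByRows L s ≡ diagByCols L s
diagByRows≡diagByCols [] d s = refl
diagByRows≡diagByCols (a ∷ rest) d zero = cong (λ b → ind b + 0) (lem a d)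
  where
  lem : ∀ a → Desc (a ∷ rest) → (a + 0 ≡ᵇ 0) ≡ (conj (a ∷ rest) 1 + 0 ≡ᵇ 0)
  lem zero d = cong (λ c → c + 0 ≡ᵇ 0) (sym (trans (conj-cons 0 rest 1) (conj-zero 0 rest 1 (Desc-at 0 rest d) (s≤s z≤n))))
  lem (suc a) d = sym (cong (λ c → c + 0 ≡ᵇ 0) (conj-cons (suc a) rest 1))
diagByRows≡diagByCols (a ∷ rest) d (suc s) = begin
    diagByRows (a ∷ rest) (suc s) ≡⟨ diagByRows-cons a rest s ⟩
    ind (a + 0 ≡ᵇ suc s) + diagByRows rest s ≡⟨ cong₂ _+_ (cong (λ x → ind (x ≡ᵇ suc s)) (+-identityʳ a)) (diagByRows≡diagByCols rest (Desc-tail a rest d) s) ⟩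
    ind (a ≡ᵇ suc s) + diagByCols rest s ≡⟨ sym (diagByCols-cons a rest s d) ⟩
    diagByCols (a ∷ rest) (suc s) ∎
  where open ≡-Reasoning

-- For δ = ν γ = (ℓ+1, γ-1) the first row of δ counts the
-- columns of γ on the diagonals ℓ and ℓ+1, plus one for the cell (1,1);
-- the first column of γ counts its rows on these diagonals, plus two.
-- With diagByRows ≡ diagByCols this gives firstRowCount δ = firstColCount γ + 1.
module FirstRowOfν (γ : List ℕ) (dγ : Desc γ) (pγ : Pos γ) where
  ℓ = length γ
  δ = suc ℓ ∷ strip (map pred γ)

  -- Cell (1, j+1) of δ: its leg is the column height γ'_{j+2}.
  cellδ : ∀ j → j < suc ℓ → dinvCell δ 1 (suc j) ≡ ((conj γ (suc (suc j)) + suc j ≡ᵇ ℓ) ∨ (conj γ (suc (suc j)) + suc j ≡ᵇ suc ℓ))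
  cellδ j (s≤s j≤ℓ) = trans (cong (λ c → armLegOk (c ∸ 1) (ℓ ∸ j)) e) (row-arith (conj γ (suc (suc j))) j ℓ j≤ℓ)
    where
    e : conj δ (suc j) ≡ suc (conj γ (suc (suc j)))
    e = trans (conj-cons (suc ℓ) (strip (map pred γ)) (suc j))
          (cong₂ (λ b c → ind b + c) (trans (≤ᵇ-suc j ℓ) (T-true (≤⇒≤ᵇ j≤ℓ))) (trans (conj-strip (map pred γ) j) (conj-pred γ j)))

  p q : ℕ → Bool
  p k = (conj γ (suc k) + k) ≡ᵇ ℓ
  q k = (conj γ (suc k) + k) ≡ᵇ suc ℓ

  -- Column 1 (diagonal ℓ) is the extra cell; columns 2, …, ℓ+2 are the first row of δ.
  diag-firstRow : diagByCols γ ℓ + diagByCols γ (suc ℓ) ≡ suc (firstRowCount δ)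
  diag-firstRow = begin
      countBelow p (suc ℓ) + countBelow q (suc (suc ℓ))
    ≡⟨ cong (_+ countBelow q (suc (suc ℓ))) (sym e1) ⟩
      countBelow p (suc (suc ℓ)) + countBelow q (suc (suc ℓ))
    ≡⟨ countBelow-∨ p q (suc (suc ℓ)) ⟩
      countBelow (λ k → p k ∨ q k) (suc (suc ℓ)) + countBelow (λ k → p k ∧ q k) (suc (suc ℓ))
    ≡⟨ cong₂ _+_ refl (countBelow-false (suc (suc ℓ)) (λ k _ → ≡ᵇ-disj (conj γ (suc k) + k) ℓ)) ⟩
      countBelow (λ k → p k ∨ q k) (suc (suc ℓ)) + 0
    ≡⟨ +-identityʳ _ ⟩
      ind (p 0 ∨ q 0) + countBelow (λ k → p (suc k) ∨ q (suc k)) (suc ℓ)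
    ≡⟨ cong₂ _+_ (cong (λ c → ind (((c + 0) ≡ᵇ ℓ) ∨ ((c + 0) ≡ᵇ suc ℓ))) (conj-Pos γ pγ) ⊙ e0)
                 (countBelow-cong (suc ℓ) (λ j lt → sym (cellδ j lt))) ⟩
      suc (firstRowCount δ) ∎
    where
    open ≡-Reasoning
    _⊙_ = trans
    e1 : countBelow p (suc (suc ℓ)) ≡ countBelow p (suc ℓ)
    e1 = countBelow-last p (suc ℓ) ⊙ (cong (λ b → countBelow p (suc ℓ) + ind b) (≡ᵇ-+suc (conj γ (suc (suc ℓ))) ℓ) ⊙ +-identityʳ _)
    e0 : ind (((ℓ + 0) ≡ᵇ ℓ) ∨ ((ℓ + 0) ≡ᵇ suc ℓ)) ≡ 1
    e0 = cong (λ x → ind ((x ≡ᵇ ℓ) ∨ (x ≡ᵇ suc ℓ))) (+-identityʳ ℓ) ⊙ cong (λ b → ind (b ∨ (ℓ ≡ᵇ suc ℓ))) (≡ᵇ-refl ℓ)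

  p' q' : ℕ → Bool
  p' i = (at γ i + i) ≡ᵇ ℓ
  q' i = (at γ i + i) ≡ᵇ suc ℓ

  -- The empty rows ℓ+1 (diagonal ℓ) and ℓ+2 (diagonal ℓ+1) are the two extra terms.
  diag-firstCol : diagByRows γ ℓ + diagByRows γ (suc ℓ) ≡ suc (suc (firstColCount γ))
  diag-firstCol = begin
      countBelow p' (suc ℓ) + countBelow q' (suc (suc ℓ))
    ≡⟨ cong₂ _+_ (countBelow-last p' ℓ) (countBelow-last q' (suc ℓ) ⊙ cong (_+ ind (q' (suc ℓ))) (countBelow-last q' ℓ)) ⟩
      (countBelow p' ℓ + ind (p' ℓ)) + ((countBelow q' ℓ + ind (q' ℓ)) + ind (q' (suc ℓ)))
    ≡⟨ cong₂ (λ x y → (countBelow p' ℓ + ind x) + ((countBelow q' ℓ + ind y) + ind (q' (suc ℓ)))) ep eq1 ⟩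
      (countBelow p' ℓ + 1) + ((countBelow q' ℓ + 0) + ind (q' (suc ℓ)))
    ≡⟨ cong (λ b → (countBelow p' ℓ + 1) + ((countBelow q' ℓ + 0) + ind b)) eq2 ⟩
      (countBelow p' ℓ + 1) + ((countBelow q' ℓ + 0) + 1)
    ≡⟨ arith (countBelow p' ℓ) (countBelow q' ℓ) ⟩
      suc (suc (countBelow p' ℓ + countBelow q' ℓ))
    ≡⟨ cong (λ x → suc (suc x)) (countBelow-∨ p' q' ℓ ⊙ (cong (countBelow (λ k → p' k ∨ q' k) ℓ +_) (countBelow-false ℓ (λ i _ → ≡ᵇ-disj (at γ i + i) ℓ)) ⊙ +-identityʳ _)) ⟩
      suc (suc (countBelow (λ k → p' k ∨ q' k) ℓ))
    ≡⟨ cong (λ x → suc (suc x)) (countBelow-cong ℓ pt) ⟩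
      suc (suc (firstColCount γ)) ∎
    where
    open ≡-Reasoning
    _⊙_ = trans
    atℓ : ∀ k → ℓ ≤ k → at γ k ≡ 0
    atℓ k h = at-beyond γ k h
    ep : p' ℓ ≡ true
    ep = cong (λ x → (x + ℓ) ≡ᵇ ℓ) (atℓ ℓ ≤-refl) ⊙ ≡ᵇ-refl ℓ
    eq1 : q' ℓ ≡ false
    eq1 = cong (λ x → (x + ℓ) ≡ᵇ suc ℓ) (atℓ ℓ ≤-refl) ⊙ ≡ᵇ-false ℓ (suc ℓ) ≤-refl
    eq2 : q' (suc ℓ) ≡ true
    eq2 = cong (λ x → (x + suc ℓ) ≡ᵇ suc ℓ) (atℓ (suc ℓ) (n≤1+n ℓ)) ⊙ ≡ᵇ-refl (suc ℓ)
    arith : ∀ x y → (x + 1) + ((y + 0) + 1) ≡ suc (suc (x + y))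
    arith x y = cong₂ _+_ (+-comm x 1) (cong (_+ 1) (+-identityʳ y) ⊙ +-comm y 1) ⊙ cong suc (+-suc x y)
    pt : ∀ i → i < ℓ → (p' i ∨ q' i) ≡ ((1 ≤ᵇ at γ i) ∧ dinvCell γ (suc i) 1)
    pt i i<ℓ with at γ i in e | Pos-at γ pγ i i<ℓ
    ... | suc a | _ = sym (cong (λ c → armLegOk (c ∸ suc i) a) (conj-Pos γ pγ) ⊙ col-arith a i ℓ i<ℓ)

  firstRow-ν : firstRowCount δ ≡ suc (firstColCount γ)
  firstRow-ν = suc-injective (trans (sym diag-firstRow) (trans (cong₂ _+_ (sym (diagByRows≡diagByCols γ dγ ℓ)) (sym (diagByRows≡diagByCols γ dγ (suc ℓ)))) diag-firstCol))

ν-onPartition : ∀ γ → Pos γ → at γ 0 ≤ length γ + 2 → ν γ ≡ just (suc (length γ) ∷ strip (map pred γ))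
ν-onPartition γ p h rewrite Pos-strip γ p | T-true (≤⇒≤ᵇ h) = cong just (consZ-suc (length γ) (strip (map pred γ)))

ν-isPartition : ∀ γ → Desc γ → Pos γ → at γ 0 ≤ length γ + 2 →
  Desc (suc (length γ) ∷ strip (map pred γ)) × Pos (suc (length γ) ∷ strip (map pred γ))
ν-isPartition γ d p h =
  Desc-cons (suc (length γ)) (strip (map pred γ)) (proj₁ DP) hd , (s≤s z≤n , proj₂ DP)
  where
  DP = Desc-strip (map pred γ) (Desc-pred γ d)
  hd : at (strip (map pred γ)) 0 ≤ suc (length γ)
  hd = subst (_≤ suc (length γ)) (sym (trans (at-strip (map pred γ) 0) (at-map-pred γ 0)))
         (subst (λ x → pred (at γ 0) ≤ pred x) (+-comm (length γ) 2) (pred-mono-≤ h))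

dinv-ν : ∀ γ → Desc γ → Pos γ → at γ 0 ≤ length γ + 2 →
  dinv (suc (length γ) ∷ strip (map pred γ)) ≡ suc (dinv γ)
dinv-ν γ d p h = begin
    dinv δ ≡⟨ dinv≡dinvΣ δ ⟩
    dinvΣ δ ≡⟨ dinv-peelRow (suc (length γ)) (strip (map pred γ)) (proj₁ (ν-isPartition γ d p h)) ⟩
    firstRowCount δ + dinvΣ (strip (map pred γ)) ≡⟨ cong₂ _+_ (FirstRowOfν.firstRow-ν γ d p) (dinvΣ-strip (map pred γ)) ⟩
    suc (firstColCount γ + dinvΣ (map pred γ)) ≡⟨ cong suc (sym (dinv-peelColumn γ d)) ⟩
    suc (dinvΣ γ) ≡⟨ cong suc (sym (dinv≡dinvΣ γ)) ⟩
    suc (dinv γ) ∎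
  where
  open ≡-Reasoning
  δ = suc (length γ) ∷ strip (map pred γ)

ν-just : ∀ γ → Pos γ → ∀ δ → ν γ ≡ just δ → (at γ 0 ≤ length γ + 2) × (δ ≡ suc (length γ) ∷ strip (map pred γ))
ν-just γ p δ e with at γ 0 ≤ᵇ (length γ + 2) in eqb
... | false = ⊥-elim (bad (trans (sym (cong (λ b → if b then just (strip (suc (length γ) ∷ map pred γ)) else nothing) eqb)) (trans (sym (ν-def)) e)))
  where
  bad : nothing ≡ just δ → ⊥
  bad ()
  ν-def : ν γ ≡ (if at γ 0 ≤ᵇ (length γ + 2) then just (strip (suc (length γ) ∷ map pred γ)) else nothing)
  ν-def rewrite Pos-strip γ p = refl
... | true = cond , just-injective (trans (sym e) (ν-onPartition γ p cond))
  where
  cond : at γ 0 ≤ length γ + 2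
  cond = ≤ᵇ⇒≤ (at γ 0) (length γ + 2) (subst T (sym eqb) tt)

dinv-νIter : ∀ γ0 → Desc γ0 → Pos γ0 → ∀ m γ → νIter m γ0 ≡ just γ → (Desc γ × Pos γ) × dinv γ ≡ m + dinv γ0
dinv-νIter γ0 d p zero γ e with e
... | refl = (d , p) , refl
dinv-νIter γ0 d p (suc m) γ e with νIter m γ0 in eq
... | nothing = ⊥-elim (bad e)
  where
  bad : nothing ≡ just γ → ⊥
  bad ()
... | just γ' with dinv-νIter γ0 d p m γ' eq
... | (d' , p') , h with ν-just γ' p' γ e
... | cond , refl = ν-isPartition γ' d' p' cond , trans (dinv-ν γ' d' p' cond) (cong suc h)

-- Row reaches.  A decreasing list γ is encoded by R with γ_i = R_i - (i+1):
-- shift k R subtracts k+1, k+2, … from the entries, and fromRows strips zeros.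

shift : ℕ → List ℕ → List ℕ
shift k [] = []
shift k (r ∷ R) = (r ∸ suc k) ∷ shift (suc k) R

fromRows : List ℕ → List ℕ
fromRows R = strip (shift 0 R)

at-shift : ∀ k R i → at (shift k R) i ≡ at R i ∸ suc (k + i)
at-shift k [] i = refl
at-shift k (r ∷ R) zero = cong (λ x → r ∸ suc x) (sym (+-identityʳ k))
at-shift k (r ∷ R) (suc i) = trans (at-shift (suc k) R i) (cong (λ x → at R i ∸ suc x) (sym (+-suc k i)))

length-shift : ∀ k R → length (shift k R) ≡ length R
length-shift k [] = refl
length-shift k (r ∷ R) = cong suc (length-shift (suc k) R)

shift-pred : ∀ k R → shift (suc k) R ≡ map pred (shift k R)
shift-pred k [] = refl
shift-pred k (r ∷ R) = cong₂ _∷_ (lem r k) (shift-pred (suc k) R)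
  where
  lem : ∀ r k → r ∸ suc (suc k) ≡ pred (r ∸ suc k)
  lem zero k = refl
  lem (suc r) zero = refl
  lem (suc r) (suc k) = lem r k

shift-map-pred : ∀ k R → map pred (shift k R) ≡ shift k (map pred R)
shift-map-pred k [] = refl
shift-map-pred k (r ∷ R) = cong₂ _∷_ (trans (pred[m∸n]≡m∸[1+n] r (suc k)) (sym (∸-+-assoc r 1 (suc k)))) (shift-map-pred (suc k) R)

shift-++ : ∀ k A B → shift k (A ++ B) ≡ shift k A ++ shift (k + length A) B
shift-++ k [] B = cong (λ x → shift x B) (sym (+-identityʳ k))
shift-++ k (x ∷ A) B = cong ((x ∸ suc k) ∷_) (trans (shift-++ (suc k) A B) (cong (λ y → shift (suc k) A ++ shift y B) (sym (+-suc k (length A)))))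

strip-pred-consZ : ∀ x s → strip (map pred (consZ x s)) ≡ consZ (pred x) (strip (map pred s))
strip-pred-consZ zero [] = refl
strip-pred-consZ (suc x) [] = refl
strip-pred-consZ zero (y ∷ s) = refl
strip-pred-consZ (suc x) (y ∷ s) = refl

strip-pred-strip : ∀ l → strip (map pred (strip l)) ≡ strip (map pred l)
strip-pred-strip [] = refl
strip-pred-strip (x ∷ l) = trans (strip-pred-consZ x (strip l)) (cong (consZ (pred x)) (strip-pred-strip l))

at-fromRows : ∀ R i → at (fromRows R) i ≡ at R i ∸ suc i
at-fromRows R i = trans (at-strip (shift 0 R) i) (at-shift 0 R i)

at-shift-pos : ∀ R i → suc i < at R i → 1 ≤ at (shift 0 R) i
at-shift-pos R i h = subst (1 ≤_) (sym (at-shift 0 R i)) (m<n⇒0<n∸m h)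

at-shift-zero : ∀ R i → at R i ≤ suc i → at (shift 0 R) i ≡ 0
at-shift-zero R i h = trans (at-shift 0 R i) (m≤n⇒m∸n≡0 h)

Reach : List ℕ → Set
Reach [] = ⊤
Reach (x ∷ []) = ⊤
Reach (x ∷ y ∷ l) = (y ≤ suc x) × Reach (y ∷ l)

Desc-shift : ∀ k R → Reach R → Desc (shift k R)
Desc-shift k [] _ = tt
Desc-shift k (x ∷ []) _ = tt
Desc-shift k (x ∷ y ∷ R) (h , r) = ∸-monoˡ-≤ (suc (suc k)) h , Desc-shift (suc k) (y ∷ R) r

Reach-++ : ∀ A B → Reach A → Reach B → (at B 0 ≤ suc (at A (pred (length A)))) → Reach (A ++ B)
Reach-++ [] B _ rB _ = rB
Reach-++ (x ∷ []) [] _ _ _ = tt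
Reach-++ (x ∷ []) (y ∷ B) _ rB h = h , rB
Reach-++ (x ∷ y ∷ A) B (h1 , rA) rB h = h1 , Reach-++ (y ∷ A) B rA rB h

ν-fromRows : ∀ R → Desc (shift 0 R) → at (fromRows R) 0 ≤ length (fromRows R) + 2 →
  ν (fromRows R) ≡ just (fromRows ((length (fromRows R) + 2) ∷ R))
ν-fromRows R d h = trans (ν-onPartition γ (proj₂ (Desc-strip (shift 0 R) d)) h) (cong just e)
  where
  γ = fromRows R
  e : suc (length γ) ∷ strip (map pred γ) ≡ strip (((length γ + 2) ∸ 1) ∷ shift 1 R)
  e = begin
      suc (length γ) ∷ strip (map pred γ)
    ≡⟨ cong (suc (length γ) ∷_) (trans (strip-pred-strip (shift 0 R)) (cong strip (sym (shift-pred 0 R)))) ⟩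
      suc (length γ) ∷ strip (shift 1 R)
    ≡⟨ sym (consZ-suc (length γ) (strip (shift 1 R))) ⟩
      consZ (suc (length γ)) (strip (shift 1 R))
    ≡⟨ cong (λ x → consZ x (strip (shift 1 R))) (sym (trans (cong (_∸ 1) (+-comm (length γ) 2)) refl)) ⟩
      consZ ((length γ + 2) ∸ 1) (strip (shift 1 R)) ∎
    where open ≡-Reasoning

cell-bound : ∀ a j x → 1 ≤ j → j ≤ x ∸ a → a + j ≤ x
cell-bound a j x h1 h with a ≤? x
... | yes a≤x = ≤-trans (+-monoʳ-≤ a h) (≤-reflexive (m+[n∸m]≡n a≤x))
... | no a≰x = ⊥-elim (<⇒≱ h1 (subst (j ≤_) (m≤n⇒m∸n≡0 (≤-trans (n≤1+n x) (≰⇒> a≰x))) h))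

isΔ-fromRows : ∀ R c p → (∀ i → at R i ≤ c) → suc p < c → at R p ≡ c → IsΔ (fromRows R) c
isΔ-fromRows R c p R≤c sp<c Rp≡c = dyck , minimal
  where
  γ = fromRows R
  dyck : DyckOfOrder γ c
  dyck (suc i) j _ _ h1 hj = ≤-trans (cell-bound (suc i) j (at R i) h1 (subst (j ≤_) (at-fromRows R i) hj)) (R≤c i)
  γp : at γ p ≡ c ∸ suc p
  γp = trans (at-fromRows R p) (cong (_∸ suc p) Rp≡c)
  inlen : suc p ≤ len γ
  inlen with suc p ≤? len γ
  ... | yes q = q
  ... | no q = ⊥-elim (<⇒≱ (subst (1 ≤_) (sym γp) (m<n⇒0<n∸m sp<c)) (≤-reflexive (at-beyond-strip γ p (≤-pred (≰⇒> q)))))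
  minimal : ∀ m → m < c → DyckOfOrder γ m → ⊥
  minimal m m<c dy = <⇒≱ m<c (subst (_≤ m) (m+[n∸m]≡n (<⇒≤ sp<c))
    (dy (suc p) (c ∸ suc p) (s≤s z≤n) inlen (m<n⇒0<n∸m sp<c) (≤-reflexive (sym γp))))

countdown : ℕ → ℕ → List ℕ
countdown a zero = []
countdown a (suc n) = (a + n) ∷ countdown a n

length-map-countdown : ∀ (f : ℕ → ℕ) a n → length (map f (countdown a n)) ≡ n
length-map-countdown f a zero = refl
length-map-countdown f a (suc n) = cong suc (length-map-countdown f a n)

at-map-countdown : ∀ (f : ℕ → ℕ) a n i → i < n → at (map f (countdown a n)) i ≡ f (a + (n ∸ suc i))
at-map-countdown f a (suc n) zero _ = refl
at-map-countdown f a (suc n) (suc i) (s≤s h) = at-map-countdown f a n i h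

split-< : ∀ p n → p < n → Σ ℕ λ e → n ≡ suc (p + e)
split-< p n lt = (n ∸ suc p) , sym (m+[n∸m]≡n lt)

+-suc-∸ : ∀ p e → suc (p + suc e) ∸ e ≡ suc (suc p)
+-suc-∸ p e = trans (cong (λ x → suc x ∸ e) (+-suc p e)) (m+n∸n≡m (suc (suc p)) e)

-- Fix z (it will be ζ(μ)) and a 0/1 sequence G with G 2 = 0
-- and G j = 0 for j ≥ z+2 (it will be j ↦ g_{j-1} for the Dyck vector g).
-- The reaches of γ_μ are rows₀ = (z+1 - G(z+1), …, z+1 - G 1).  Block t of the
-- orbit runs at order c = z+2+t: its state p ≤ z+t prepends
-- (c - G(p+2), …, c - G 2) to the reaches `history t` left by the earlier
-- blocks.
module Orbit (z : ℕ) (G : ℕ → ℕ) (G≤1 : ∀ j → G j ≤ 1) (G2 : G 2 ≡ 0)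
             (Gbig : ∀ j → suc (suc z) ≤ j → G j ≡ 0) where

  entry : ℕ → ℕ → ℕ
  entry c j = c ∸ G j

  entry-≤ : ∀ c j → entry c j ≤ c
  entry-≤ c j = m∸n≤m c (G j)

  entry-≥ : ∀ c j → c ∸ 1 ≤ entry c j
  entry-≥ c j = ∸-monoʳ-≤ c (G≤1 j)

  block : ℕ → ℕ → List ℕ
  block c n = map (entry c) (countdown 2 n)

  rows₀ : List ℕ
  rows₀ = map (entry (suc z)) (countdown 1 (suc z))

  order : ℕ → ℕ
  order t = suc (suc (z + t))

  history : ℕ → List ℕ
  history zero = rows₀
  history (suc t) = block (order t) (suc (z + t)) ++ history t

  state : ℕ → ℕ → List ℕ
  state t p = block (order t) (suc p) ++ history t

  history-≤ : ∀ t s → at (history t) s ≤ suc (z + t)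
  history-≤ zero s = subst (λ x → at rows₀ s ≤ suc x) (sym (+-identityʳ z)) (at-map-≤ (entry (suc z)) (suc z) (countdown 1 (suc z)) (entry-≤ (suc z)) s)
  history-≤ (suc t) s = subst (λ x → at (history (suc t)) s ≤ suc x) (sym (+-suc z t))
    (at-++-≤ (block (order t) (suc (z + t))) (history t) (order t) (at-map-≤ (entry (order t)) (order t) (countdown 2 (suc (z + t))) (entry-≤ (order t)))
       (λ i → ≤-trans (history-≤ t i) (n≤1+n _)) s)

  state-≤ : ∀ t p i → at (state t p) i ≤ order t
  state-≤ t p i = at-++-≤ (block (order t) (suc p)) (history t) (order t) (at-map-≤ (entry (order t)) (order t) (countdown 2 (suc p)) (entry-≤ (order t)))
       (λ i → ≤-trans (history-≤ t i) (n≤1+n _)) i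

  history-at : ∀ t s → s < z + t → at (history t) s ≡ entry (suc (z + t)) (suc ((z + t) ∸ s))
  history-at zero s lt rewrite +-identityʳ z = at-map-countdown (entry (suc z)) 1 (suc z) s (≤-trans lt (n≤1+n z))
  history-at (suc t) s lt = begin
      at (block (order t) (suc (z + t)) ++ history t) s
    ≡⟨ at-++ˡ (block (order t) (suc (z + t))) (history t) s (subst (s <_) (sym (length-map-countdown (entry (order t)) 2 (suc (z + t)))) lt') ⟩
      at (block (order t) (suc (z + t))) s
    ≡⟨ at-map-countdown (entry (order t)) 2 (suc (z + t)) s lt' ⟩
      entry (order t) (2 + (z + t ∸ s))
    ≡⟨ cong₂ entry (cong suc (sym (+-suc z t))) (cong suc (trans (sym (+-∸-assoc 1 (≤-pred lt'))) (cong (_∸ s) (sym (+-suc z t))))) ⟩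
      entry (suc (z + suc t)) (suc ((z + suc t) ∸ s)) ∎
    where
    open ≡-Reasoning
    lt' : s < suc (z + t)
    lt' = subst (s <_) (+-suc z t) lt

  history-≥ : ∀ t s → s < z + t → z + t ≤ at (history t) s
  history-≥ t s lt = subst (z + t ≤_) (sym (history-at t s lt)) (entry-≥ (suc (z + t)) _)

  state-block : ∀ t p i → i ≤ p → at (state t p) i ≡ entry (order t) (2 + (p ∸ i))
  state-block t p i i≤p = trans (at-++ˡ (block (order t) (suc p)) (history t) i (subst (i <_) (sym (length-map-countdown (entry (order t)) 2 (suc p))) (s≤s i≤p)))
                           (at-map-countdown (entry (order t)) 2 (suc p) i (s≤s i≤p))

  state-history : ∀ t p s → at (state t p) (suc p + s) ≡ at (history t) s
  state-history t p s = trans (cong (λ x → at (state t p) (x + s)) (sym (length-map-countdown (entry (order t)) 2 (suc p))))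
                        (at-++ʳ (block (order t) (suc p)) (history t) s)

  state-top : ∀ t p → at (state t p) p ≡ order t
  state-top t p = trans (state-block t p p ≤-refl) (trans (cong (λ x → order t ∸ G (2 + x)) (n∸n≡0 p)) (cong (order t ∸_) G2))

  ≤suc-entry : ∀ c j → c ≤ suc (entry c j)
  ≤suc-entry c j = ≤-trans (lem c) (s≤s (entry-≥ c j))
    where
    lem : ∀ c → c ≤ suc (c ∸ 1)
    lem zero = z≤n
    lem (suc c) = ≤-refl

  Reach-countdown : ∀ c a n → Reach (map (entry c) (countdown a n))
  Reach-countdown c a zero = tt
  Reach-countdown c a (suc zero) = tt
  Reach-countdown c a (suc (suc n)) = ≤-trans (entry-≤ c _) (≤suc-entry c _) , Reach-countdown c a (suc n)

  block-≥ : ∀ c a n i → i < n → c ∸ 1 ≤ at (map (entry c) (countdown a n)) i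
  block-≥ c a n i lt = subst (c ∸ 1 ≤_) (sym (at-map-countdown (entry c) a n i lt)) (entry-≥ c _)

  Reach-history : ∀ t → Reach (history t)
  Reach-history zero = Reach-countdown (suc z) 1 (suc z)
  Reach-history (suc t) = Reach-++ (block (order t) (suc (z + t))) (history t) (Reach-countdown (order t) 2 (suc (z + t))) (Reach-history t)
    (≤-trans (history-≤ t 0) (≤-trans (block-≥ (order t) 2 (suc (z + t)) _ lt) (n≤1+n _)))
    where
    lt : pred (length (block (order t) (suc (z + t)))) < suc (z + t)
    lt = subst (λ x → pred x < suc (z + t)) (sym (length-map-countdown (entry (order t)) 2 (suc (z + t)))) ≤-refl

  Reach-state : ∀ t p → Reach (state t p)
  Reach-state t p = Reach-++ (block (order t) (suc p)) (history t) (Reach-countdown (order t) 2 (suc p)) (Reach-history t)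
    (≤-trans (history-≤ t 0) (≤-trans (block-≥ (order t) 2 (suc p) _ lt) (n≤1+n _)))
    where
    lt : pred (length (block (order t) (suc p))) < suc p
    lt = subst (λ x → pred x < suc p) (sym (length-map-countdown (entry (order t)) 2 (suc p))) ≤-refl

  Desc-state : ∀ t p → Desc (shift 0 (state t p))
  Desc-state t p = Desc-shift 0 (state t p) (Reach-state t p)

  Desc-rows₀ : Desc (shift 0 rows₀)
  Desc-rows₀ = Desc-shift 0 rows₀ (Reach-countdown (suc z) 1 (suc z))

  -- Lengths of the partitions along the orbit: the first row i whose reach is
  -- ≤ i+1.  Inside block t the current block is long, so the answer is read
  -- off the history; whether it is one more or not depends on G (p+3).
  state-block-pos : ∀ t p i → i ≤ p → i < z + t → suc i < at (state t p) i
  state-block-pos t p i i≤p lt = ≤-trans (s≤s lt) (subst (suc (z + t) ≤_) (sym (state-block t p i i≤p)) (entry-≥ (order t) _))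

  length-blockEnd : ∀ t → length (fromRows (state t (z + t))) ≡ suc (z + t)
  length-blockEnd t = length-strip-lastPositive (shift 0 (state t (z + t))) (z + t) (Desc-state t (z + t))
    (at-shift-pos (state t (z + t)) (z + t) (subst (suc (z + t) <_) (sym (state-top t (z + t))) ≤-refl))
    (at-shift-zero (state t (z + t)) (suc (z + t)) (state-≤ t (z + t) (suc (z + t))))

  length-inBlock₀ : ∀ t p e → z + t ≡ suc (p + e) → G (3 + p) ≡ 0 → length (fromRows (state t p)) ≡ suc (p + e)
  length-inBlock₀ t p e hz hG = length-strip-lastPositive (shift 0 (state t p)) (p + e) (Desc-state t p) (pos e hz) zer
    where
    zer : at (shift 0 (state t p)) (suc (p + e)) ≡ 0
    zer = at-shift-zero (state t p) (suc (p + e)) (subst (_≤ suc (suc (p + e))) (sym (state-history t p e))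
            (subst (λ x → at (history t) e ≤ suc x) hz (history-≤ t e)))
    pos : ∀ e → z + t ≡ suc (p + e) → 1 ≤ at (shift 0 (state t p)) (p + e)
    pos zero hz = at-shift-pos (state t p) (p + 0) (subst (λ x → suc x < at (state t p) x) (sym (+-identityʳ p))
                   (state-block-pos t p p ≤-refl (subst (p <_) (sym hz) (s≤s (≤-reflexive (sym (+-identityʳ p)))))))
    pos (suc e') hz = at-shift-pos (state t p) (p + suc e') (subst (λ x → suc x < at (state t p) x) (sym (+-suc p e'))
                   (subst (suc (suc (p + e')) <_) (sym (trans (state-history t p e') val))
                      (subst (λ x → suc (suc (p + e')) < suc x) (sym hz) (s≤s (s≤s (≤-reflexive (sym (+-suc p e'))))))))
      where
      val : at (history t) e' ≡ suc (z + t)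
      val = begin
          at (history t) e'
        ≡⟨ history-at t e' (subst (e' <_) (sym hz) (s≤s (≤-trans (n≤1+n e') (m≤n+m (suc e') p)))) ⟩
          suc (z + t) ∸ G (suc (z + t ∸ e'))
        ≡⟨ cong (λ x → suc (z + t) ∸ G (suc (x ∸ e'))) hz ⟩
          suc (z + t) ∸ G (suc (suc (p + suc e') ∸ e'))
        ≡⟨ cong (λ x → suc (z + t) ∸ G (suc x)) (+-suc-∸ p e') ⟩
          suc (z + t) ∸ G (3 + p)
        ≡⟨ cong (suc (z + t) ∸_) hG ⟩
          suc (z + t) ∎
        where open ≡-Reasoning

  length-inBlock₁ : ∀ t p e → z + t ≡ suc (p + suc e) → G (3 + p) ≡ 1 → length (fromRows (state t p)) ≡ suc (p + e)
  length-inBlock₁ t p e hz hG = length-strip-lastPositive (shift 0 (state t p)) (p + e) (Desc-state t p) (pos e hz) zer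
    where
    val : at (history t) e ≡ z + t
    val = begin
          at (history t) e
        ≡⟨ history-at t e (subst (e <_) (sym hz) (s≤s (≤-trans (n≤1+n e) (m≤n+m (suc e) p)))) ⟩
          suc (z + t) ∸ G (suc (z + t ∸ e))
        ≡⟨ cong (λ x → suc (z + t) ∸ G (suc (x ∸ e))) hz ⟩
          suc (z + t) ∸ G (suc (suc (p + suc e) ∸ e))
        ≡⟨ cong (λ x → suc (z + t) ∸ G (suc x)) (+-suc-∸ p e) ⟩
          suc (z + t) ∸ G (3 + p)
        ≡⟨ cong (suc (z + t) ∸_) hG ⟩
          z + t ∎
        where open ≡-Reasoning
    zer : at (shift 0 (state t p)) (suc (p + e)) ≡ 0
    zer = at-shift-zero (state t p) (suc (p + e)) (subst (_≤ suc (suc (p + e))) (sym (trans (state-history t p e) val))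
            (subst (_≤ suc (suc (p + e))) (sym hz) (s≤s (≤-reflexive (+-suc p e)))))
    pos : ∀ e → z + t ≡ suc (p + suc e) → 1 ≤ at (shift 0 (state t p)) (p + e)
    pos zero hz = at-shift-pos (state t p) (p + 0) (subst (λ x → suc x < at (state t p) x) (sym (+-identityʳ p))
                   (state-block-pos t p p ≤-refl (subst (p <_) (sym hz) (s≤s (m≤m+n p 1)))))
    pos (suc e') hz = at-shift-pos (state t p) (p + suc e') (subst (λ x → suc x < at (state t p) x) (sym (+-suc p e'))
                   (≤-trans lt (subst (z + t ≤_) (sym (state-history t p e')) (history-≥ t e' lt2))))
      where
      lt2 : e' < z + t
      lt2 = subst (e' <_) (sym hz) (s≤s (≤-trans (≤-trans (n≤1+n e') (n≤1+n (suc e'))) (m≤n+m (suc (suc e')) p)))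
      lt : suc (suc (p + e')) < z + t
      lt = subst (suc (suc (p + e')) <_) (sym hz) (s≤s (≤-reflexive (sym (trans (+-suc p (suc e')) (cong suc (+-suc p e'))))))

  length-rows₀ : length (fromRows rows₀) ≡ z
  length-rows₀ = lem z refl
    where
    lem : ∀ z' → z' ≡ z → length (fromRows rows₀) ≡ z'
    lem zero e = length-strip-firstZero (shift 0 rows₀) 0 Desc-rows₀ (λ _ ()) (at-shift-zero rows₀ 0 (subst (λ x → at rows₀ 0 ≤ suc x) (trans (+-identityʳ z) (sym e)) (history-≤ 0 0)))
    lem (suc z') e = length-strip-lastPositive (shift 0 rows₀) z' Desc-rows₀
      (at-shift-pos rows₀ z' (subst (suc z' <_) (sym v) (subst (λ x → suc z' < suc x) e ≤-refl)))
      (at-shift-zero rows₀ (suc z') (subst (λ x → at rows₀ (suc z') ≤ suc x) (sym e) (subst (λ x → at rows₀ (suc z') ≤ suc x) (+-identityʳ z) (history-≤ 0 (suc z')))))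
      where
      v : at rows₀ z' ≡ suc z
      v = begin
          at rows₀ z'
        ≡⟨ at-map-countdown (entry (suc z)) 1 (suc z) z' (subst (λ x → z' < suc x) e (≤-trans (n≤1+n (suc z')) ≤-refl)) ⟩
          suc z ∸ G (1 + (z ∸ z'))
        ≡⟨ cong (λ x → suc z ∸ G (1 + (x ∸ z'))) (sym e) ⟩
          suc z ∸ G (1 + (suc z' ∸ z'))
        ≡⟨ cong (λ x → suc z ∸ G (1 + x)) (trans (+-∸-assoc 1 {z'} ≤-refl) (cong suc (n∸n≡0 z'))) ⟩
          suc z ∸ G 2
        ≡⟨ cong (suc z ∸_) G2 ⟩
          suc z ∎
        where open ≡-Reasoning

  G-binary : ∀ j → (G j ≡ 0) ⊎ (G j ≡ 1)
  G-binary j with G j | G≤1 j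
  ... | zero | _ = inj₁ refl
  ... | suc zero | _ = inj₂ refl
  ... | suc (suc _) | s≤s ()

  -- The next prepended reach ℓ+2 is exactly order t - G (p+3).
  length-next : ∀ t p → p < z + t → length (fromRows (state t p)) + 2 ≡ order t ∸ G (3 + p)
  length-next t p lt with split-< p (z + t) lt | G-binary (3 + p)
  ... | e , hz | inj₁ g0 = begin
        length (fromRows (state t p)) + 2 ≡⟨ cong (_+ 2) (length-inBlock₀ t p e hz g0) ⟩
        suc (p + e) + 2 ≡⟨ +-comm (suc (p + e)) 2 ⟩
        suc (suc (suc (p + e))) ≡⟨ cong (λ x → suc (suc x)) (sym hz) ⟩
        order t ≡⟨ cong (order t ∸_) (sym g0) ⟩
        order t ∸ G (3 + p) ∎
    where open ≡-Reasoning
  ... | zero , hz | inj₂ g1 = ⊥-elim (0≢1 (trans (sym (Gbig (3 + p) big)) g1))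
    where
    0≢1 : 0 ≡ 1 → ⊥
    0≢1 ()
    big : suc (suc z) ≤ 3 + p
    big = s≤s (s≤s (subst (z ≤_) (trans hz (cong suc (+-identityʳ p))) (m≤m+n z t)))
  ... | suc e' , hz | inj₂ g1 = begin
        length (fromRows (state t p)) + 2 ≡⟨ cong (_+ 2) (length-inBlock₁ t p e' hz g1) ⟩
        suc (p + e') + 2 ≡⟨ +-comm (suc (p + e')) 2 ⟩
        suc (suc (suc (p + e'))) ≡⟨ cong (λ x → suc (suc x)) (sym (+-suc p e')) ⟩
        suc (suc (p + suc e')) ≡⟨ cong suc (sym hz) ⟩
        suc (z + t) ≡⟨ cong (order t ∸_) (sym g1) ⟩
        order t ∸ G (3 + p) ∎
    where open ≡-Reasoning

  ν-inBlock : ∀ t p → p < z + t → ν (fromRows (state t p)) ≡ just (fromRows (state t (suc p)))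
  ν-inBlock t p lt = trans (ν-fromRows (state t p) (Desc-state t p) cond) (cong (λ x → just (fromRows (x ∷ state t p))) (length-next t p lt))
    where
    cond : at (fromRows (state t p)) 0 ≤ length (fromRows (state t p)) + 2
    cond = subst (_≤ length (fromRows (state t p)) + 2) (sym (at-fromRows (state t p) 0))
      (≤-trans (∸-monoˡ-≤ 1 (state-≤ t p 0)) (≤-trans (∸-monoʳ-≤ (order t) (G≤1 (3 + p))) (≤-reflexive (sym (length-next t p lt)))))

  ν-blockEnd : ∀ t → ν (fromRows (state t (z + t))) ≡ just (fromRows (state (suc t) 0))
  ν-blockEnd t = trans (ν-fromRows (state t (z + t)) (Desc-state t (z + t)) cond) (cong (λ x → just (fromRows (x ∷ state t (z + t)))) e)
    where
    e : length (fromRows (state t (z + t))) + 2 ≡ order (suc t) ∸ G 2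
    e = trans (cong (_+ 2) (length-blockEnd t)) (trans (+-comm (suc (z + t)) 2)
          (trans (cong (λ x → suc (suc x)) (sym (+-suc z t))) (cong (order (suc t) ∸_) (sym G2))))
    cond : at (fromRows (state t (z + t))) 0 ≤ length (fromRows (state t (z + t))) + 2
    cond = subst (_≤ length (fromRows (state t (z + t))) + 2) (sym (at-fromRows (state t (z + t)) 0))
      (≤-trans (∸-monoˡ-≤ 1 (state-≤ t (z + t) 0)) (subst (suc (z + t) ≤_) (sym (cong (_+ 2) (length-blockEnd t))) (m≤m+n (suc (z + t)) 2)))

  ν-rows₀ : ν (fromRows rows₀) ≡ just (fromRows (state 0 0))
  ν-rows₀ = trans (ν-fromRows rows₀ Desc-rows₀ cond) (cong (λ x → just (fromRows (x ∷ rows₀))) e)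
    where
    e : length (fromRows rows₀) + 2 ≡ order 0 ∸ G 2
    e = trans (cong (_+ 2) length-rows₀) (trans (+-comm z 2) (trans (cong (λ x → suc (suc x)) (sym (+-identityʳ z))) (cong (order 0 ∸_) (sym G2))))
    cond : at (fromRows rows₀) 0 ≤ length (fromRows rows₀) + 2
    cond = subst (_≤ length (fromRows rows₀) + 2) (sym (at-fromRows rows₀ 0))
      (≤-trans (∸-monoˡ-≤ 1 (subst (λ x → at rows₀ 0 ≤ suc x) (+-identityʳ z) (history-≤ 0 0)))
        (subst (z ≤_) (sym (cong (_+ 2) length-rows₀)) (m≤m+n z 2)))

  orbit : ∀ t p → p ≤ z + t → νIter (suc (blockStart z t + p)) (fromRows rows₀) ≡ just (fromRows (state t p))
  orbit zero zero _ = ν-rows₀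
  orbit (suc t) zero _ = begin
      νIter (suc (blockStart z t + (suc z + t) + 0)) (fromRows rows₀)
    ≡⟨ cong (λ x → νIter (suc x) (fromRows rows₀)) (trans (+-identityʳ _) (+-suc (blockStart z t) (z + t))) ⟩
      (νIter (suc (blockStart z t + (z + t))) (fromRows rows₀) >>= ν)
    ≡⟨ cong (_>>= ν) (orbit t (z + t) ≤-refl) ⟩
      ν (fromRows (state t (z + t)))
    ≡⟨ ν-blockEnd t ⟩
      just (fromRows (state (suc t) 0)) ∎
    where open ≡-Reasoning
  orbit t (suc p) h = begin
      νIter (suc (blockStart z t + suc p)) (fromRows rows₀)
    ≡⟨ cong (λ x → νIter (suc x) (fromRows rows₀)) (+-suc (blockStart z t) p) ⟩
      (νIter (suc (blockStart z t + p)) (fromRows rows₀) >>= ν)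
    ≡⟨ cong (_>>= ν) (orbit t p (≤-trans (n≤1+n p) h)) ⟩
      ν (fromRows (state t p))
    ≡⟨ ν-inBlock t p h ⟩
      just (fromRows (state t (suc p))) ∎
    where open ≡-Reasoning

  blockDecomposition : ∀ k → Σ ℕ λ t → Σ ℕ λ p → (p ≤ z + t) × (k ≡ blockStart z t + p)
  blockDecomposition zero = 0 , 0 , z≤n , refl
  blockDecomposition (suc k) with blockDecomposition k
  ... | t , p , h , e with p <? z + t
  ... | yes lt = t , suc p , lt , trans (cong suc e) (sym (+-suc (blockStart z t) p))
  ... | no nlt = suc t , 0 , z≤n , trans (cong suc e) (sym (trans (+-identityʳ _) (trans (cong (blockStart z t +_) (cong suc (sym pe))) (+-suc (blockStart z t) p))))
    where
    pe : p ≡ z + t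
    pe = ≤-antisym h (≮⇒≥ nlt)

  order≡ : ∀ t → z + 2 + t ≡ order t
  order≡ t = trans (+-assoc z 2 t) (trans (+-suc z (suc t)) (cong suc (+-suc z t)))

  isΔ : ∀ t p → p ≤ z + t → IsΔ (fromRows (state t p)) (z + 2 + t)
  isΔ t p h = subst (IsΔ (fromRows (state t p))) (sym (order≡ t))
    (isΔ-fromRows (state t p) (order t) p (state-≤ t p) (s≤s (s≤s h)) (state-top t p))

-- For v = (v_1, …, v_n) the partition
-- dyckPath v = dp_n(v) has reaches (n - v_n, …, n - v_1) (row i reaches
-- n - v_{n-i}).  Its dinv is an explicit weight of the word v_2 … v_n:
-- a 0 contributes 1 + #(later 0s), a 1 contributes #(later letters).

Binary : List ℕ → Set
Binary [] = ⊤
Binary (x ∷ l) = (x ≤ 1) × Binary l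

Binary-++ : ∀ A B → Binary A → Binary B → Binary (A ++ B)
Binary-++ [] B _ b = b
Binary-++ (x ∷ A) B (h , a) b = h , Binary-++ A B a b

Binary-reverse : ∀ l → Binary l → Binary (reverse l)
Binary-reverse [] _ = tt
Binary-reverse (x ∷ l) (h , b) = subst Binary (sym (unfold-reverse x l)) (Binary-++ (reverse l) (x ∷ []) (Binary-reverse l b) (h , tt))

Binary-at : ∀ l → Binary l → ∀ i → at l i ≤ 1
Binary-at [] _ i = z≤n
Binary-at (x ∷ l) (h , b) zero = h
Binary-at (x ∷ l) (h , b) (suc i) = Binary-at l b i

zeros : List ℕ → ℕ
zeros [] = 0
zeros (zero ∷ w) = suc (zeros w)
zeros (suc _ ∷ w) = zeros w

weight : List ℕ → ℕ
weight [] = 0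
weight (zero ∷ w) = suc (zeros w) + weight w
weight (suc _ ∷ w) = length w + weight w

zeros-++ : ∀ A B → zeros (A ++ B) ≡ zeros A + zeros B
zeros-++ [] B = refl
zeros-++ (zero ∷ A) B = cong suc (zeros-++ A B)
zeros-++ (suc _ ∷ A) B = zeros-++ A B

zeros-rev : ∀ l → zeros (reverse l) ≡ zeros l
zeros-rev [] = refl
zeros-rev (x ∷ l) = trans (cong zeros (unfold-reverse x l)) (trans (zeros-++ (reverse l) (x ∷ []))
  (trans (cong (_+ zeros (x ∷ [])) (zeros-rev l)) (lem x)))
  where
  lem : ∀ x → zeros l + zeros (x ∷ []) ≡ zeros (x ∷ l)
  lem zero = +-comm (zeros l) 1
  lem (suc x) = +-identityʳ (zeros l)

count-zeros : ∀ l → countBelow (λ i → at l i ≡ᵇ 0) (length l) ≡ zeros l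
count-zeros [] = refl
count-zeros (zero ∷ l) = cong suc (count-zeros l)
count-zeros (suc x ∷ l) = count-zeros l

dyckPath : List ℕ → List ℕ
dyckPath v = fromRows (map (length v ∸_) (reverse v))

Reach-binary : ∀ n l → Binary l → Reach (map (n ∸_) l)
Reach-binary n [] _ = tt
Reach-binary n (x ∷ []) _ = tt
Reach-binary n (x ∷ y ∷ l) (hx , hy , b) = ≤-trans (m∸n≤m n y) (lem n x hx) , Reach-binary n (y ∷ l) (hy , b)
  where
  lem : ∀ n x → x ≤ 1 → n ≤ suc (n ∸ x)
  lem n zero _ = n≤1+n n
  lem zero (suc zero) _ = z≤n
  lem (suc n) (suc zero) _ = ≤-refl
  lem _ (suc (suc _)) (s≤s ())

strip-++0 : ∀ L → strip (L ++ (0 ∷ [])) ≡ strip L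
strip-++0 [] = refl
strip-++0 (x ∷ L) = cong (consZ x) (strip-++0 L)

-- A last reach ≤ its index + 1 is an empty row.
fromRows-snoc-short : ∀ A a → a ≤ suc (length A) → fromRows (A ++ (a ∷ [])) ≡ fromRows A
fromRows-snoc-short A a h = trans (cong strip (shift-++ 0 A (a ∷ [])))
  (trans (cong (λ y → strip (shift 0 A ++ (y ∷ []))) (m≤n⇒m∸n≡0 h)) (strip-++0 (shift 0 A)))

-- Lowering the parts of dyckPath v by one gives dyckPath of the tail of v
-- (up to an empty last row), because the reaches drop by one.
map-pred-∸ : ∀ n l → map pred (map (suc n ∸_) l) ≡ map (n ∸_) l
map-pred-∸ n [] = refl
map-pred-∸ n (x ∷ l) = cong₂ _∷_ (trans (cong pred (refl {x = suc n ∸ x})) (lem n x)) (map-pred-∸ n l)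
  where
  lem : ∀ n x → pred (suc n ∸ x) ≡ n ∸ x
  lem n zero = refl
  lem n (suc x) = pred[m∸n]≡m∸[1+n] n x

dinv-fromRows : ∀ R → dinv (fromRows R) ≡ dinvΣ (shift 0 R)
dinv-fromRows R = trans (dinv≡dinvΣ (fromRows R)) (dinvΣ-strip (shift 0 R))

-- The rows of the Dyck path of a binary word lie on the diagonal m+1-u.
binaryRow-diag : ∀ m u i → u ≤ 1 → i < m → ((suc (suc m) ∸ u) ∸ suc i) + i ≡ suc m ∸ u
binaryRow-diag m zero i _ lt = m∸n+n≡m (≤-trans (<⇒≤ lt) (n≤1+n m))
binaryRow-diag m (suc zero) i _ lt = m∸n+n≡m (<⇒≤ lt)
binaryRow-diag m (suc (suc _)) i (s≤s ()) lt

binaryRow-pos : ∀ m u i → u ≤ 1 → i < m → 1 ≤ (suc (suc m) ∸ u) ∸ suc i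
binaryRow-pos m zero i _ lt = m<n⇒0<n∸m (≤-trans (s≤s lt) (n≤1+n (suc m)))
binaryRow-pos m (suc zero) i _ lt = m<n⇒0<n∸m lt
binaryRow-pos m (suc (suc _)) i (s≤s ()) lt

firstColCount-diag : ∀ l → Desc l → firstColCount l ≡ countBelow (λ i → (1 ≤ᵇ at l i) ∧ ((at l i + i ≡ᵇ length (strip l)) ∨ (at l i + i ≡ᵇ suc (length (strip l))))) (length l)
firstColCount-diag l d = countBelow-cong (length l) pt
  where
  ℓ = length (strip l)
  pt : ∀ i → i < length l → ((1 ≤ᵇ at l i) ∧ dinvCell l (suc i) 1) ≡ ((1 ≤ᵇ at l i) ∧ ((at l i + i ≡ᵇ ℓ) ∨ (at l i + i ≡ᵇ suc ℓ)))
  pt i _ with at l i in e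
  ... | zero = refl
  ... | suc a = trans (cong (λ c → armLegOk (c ∸ suc i) a) (conj1-strip l d)) (col-arith a i ℓ i<ℓ)
    where
    i<ℓ : i < ℓ
    i<ℓ with i <? ℓ
    ... | yes q = q
    ... | no q = ⊥-elim (0≢s (trans (sym (at-beyond-strip l i (≮⇒≥ q))) e))
      where
      0≢s : ∀ {a} → 0 ≡ suc a → ⊥
      0≢s ()

-- First column of the Dyck path of x ∷ y ∷ rest: rows before the last two lie
-- on the diagonal m+1-u; the count is 1 + #(0s in rest) if y = 0 and m if y = 1.
module FirstColumn (x y : ℕ) (rest : List ℕ) (hx : x ≤ 1) (hy : y ≤ 1) (brest : Binary rest) where
  m = length rest
  n = suc (suc m)
  A = map (n ∸_) (reverse rest)
  R' = A ++ ((n ∸ y) ∷ (n ∸ x) ∷ [])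
  l = shift 0 R'
  u : ℕ → ℕ
  u i = at (reverse rest) i

  lenA : length A ≡ m
  lenA = trans (length-map (n ∸_) (reverse rest)) (length-reverse rest)

  u≤1 : ∀ i → u i ≤ 1
  u≤1 = Binary-at (reverse rest) (Binary-reverse rest brest)

  R≡ : map (n ∸_) (reverse (x ∷ y ∷ rest)) ≡ R'
  R≡ = begin
      map (n ∸_) (reverse (x ∷ y ∷ rest))
    ≡⟨ cong (map (n ∸_)) (trans (unfold-reverse x (y ∷ rest)) (cong (_++ (x ∷ [])) (unfold-reverse y rest))) ⟩
      map (n ∸_) ((reverse rest ++ (y ∷ [])) ++ (x ∷ []))
    ≡⟨ cong (map (n ∸_)) (++-assoc (reverse rest) (y ∷ []) (x ∷ [])) ⟩
      map (n ∸_) (reverse rest ++ (y ∷ x ∷ []))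
    ≡⟨ map-++ (n ∸_) (reverse rest) (y ∷ x ∷ []) ⟩
      R' ∎
    where open ≡-Reasoning

  at-l : ∀ i → at l i ≡ at R' i ∸ suc i
  at-l i = at-shift 0 R' i

  at-lo : ∀ i → i < m → at l i ≡ (n ∸ u i) ∸ suc i
  at-lo i lt = trans (at-l i) (cong (_∸ suc i) (trans (at-++ˡ A _ i (subst (i <_) (sym lenA) lt))
                     (at-map (n ∸_) (reverse rest) i (subst (i <_) (sym (length-reverse rest)) lt))))

  at-m : at l m ≡ (n ∸ y) ∸ suc m
  at-m = trans (at-l m) (cong (_∸ suc m) (trans (cong (at R') (sym (trans (+-identityʳ _) lenA))) (at-++ʳ A _ 0)))

  at-m1 : at l (suc m) ≡ 0
  at-m1 = trans (at-l (suc m)) (trans (cong (_∸ suc (suc m)) (trans (cong (at R') (sym (trans (+-suc _ 0) (cong suc (trans (+-identityʳ _) lenA))))) (at-++ʳ A _ 1)))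
            (m≤n⇒m∸n≡0 (m∸n≤m n x)))

  lenl : length l ≡ suc (suc m)
  lenl = trans (length-shift 0 R') (trans (length-++ A) (trans (+-comm (length A) 2) (cong (λ k → suc (suc k)) lenA)))

  Dl : Desc l
  Dl = Desc-shift 0 R' (subst Reach R≡ (Reach-binary n (reverse (x ∷ y ∷ rest)) (Binary-reverse (x ∷ y ∷ rest) (hx , hy , brest))))

  term : ℕ → ℕ → Bool
  term L i = (1 ≤ᵇ at l i) ∧ ((at l i + i ≡ᵇ L) ∨ (at l i + i ≡ᵇ suc L))

  term-lo : ∀ L i → i < m → term L i ≡ ((suc m ∸ u i ≡ᵇ L) ∨ (suc m ∸ u i ≡ᵇ suc L))
  term-lo L i lt = begin
      term L i
    ≡⟨ cong (λ a → (1 ≤ᵇ a) ∧ ((a + i ≡ᵇ L) ∨ (a + i ≡ᵇ suc L))) (at-lo i lt) ⟩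
      (1 ≤ᵇ a) ∧ ((a + i ≡ᵇ L) ∨ (a + i ≡ᵇ suc L))
    ≡⟨ cong₂ (λ b c → b ∧ ((c ≡ᵇ L) ∨ (c ≡ᵇ suc L))) (1≤ᵇ a (binaryRow-pos m (u i) i (u≤1 i) lt)) (binaryRow-diag m (u i) i (u≤1 i) lt) ⟩
      (suc m ∸ u i ≡ᵇ L) ∨ (suc m ∸ u i ≡ᵇ suc L) ∎
    where
    open ≡-Reasoning
    a = (n ∸ u i) ∸ suc i

  term-zero : ∀ L i → at l i ≡ 0 → term L i ≡ false
  term-zero L i e = cong (λ a → (1 ≤ᵇ a) ∧ ((a + i ≡ᵇ L) ∨ (a + i ≡ᵇ suc L))) e

  firstColCount≡ : firstColCount l ≡ countBelow (term (length (strip l))) (suc (suc m))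
  firstColCount≡ = trans (firstColCount-diag l Dl) (cong (countBelow (term (length (strip l)))) lenl)

  count-split : ∀ L → countBelow (term L) (suc (suc m)) ≡ (countBelow (term L) m + ind (term L m)) + ind (term L (suc m))
  count-split L = trans (countBelow-last (term L) (suc m)) (cong (_+ ind (term L (suc m))) (countBelow-last (term L) m))

  -- y = 0: ℓ = m+1; the rows with u = 0 and row m are counted.
  colY0 : y ≡ 0 → firstColCount l ≡ suc (zeros rest)
  colY0 refl = begin
      firstColCount l
    ≡⟨ firstColCount≡ ⟩
      countBelow (term ℓ) (suc (suc m))
    ≡⟨ cong (λ L → countBelow (term L) (suc (suc m))) ℓeq ⟩
      countBelow (term (suc m)) (suc (suc m))
    ≡⟨ count-split (suc m) ⟩
      (countBelow (term (suc m)) m + ind (term (suc m) m)) + ind (term (suc m) (suc m))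
    ≡⟨ cong₂ (λ a b → (countBelow (term (suc m)) m + ind a) + ind b) tm (term-zero (suc m) (suc m) at-m1) ⟩
      (countBelow (term (suc m)) m + 1) + 0
    ≡⟨ cong (λ k → (k + 1) + 0) (trans (countBelow-cong m (λ i lt → trans (term-lo (suc m) i lt) (pt (u i) (u≤1 i)))) cz) ⟩
      (zeros rest + 1) + 0
    ≡⟨ trans (+-identityʳ _) (+-comm (zeros rest) 1) ⟩
      suc (zeros rest) ∎
    where
    open ≡-Reasoning
    ℓ = length (strip l)
    am : at l m ≡ 1
    am = trans at-m (m+n∸n≡m 1 m)
    pos : ∀ i → i < suc m → 1 ≤ at l i
    pos i lt with i <? m
    ... | yes q = subst (1 ≤_) (sym (at-lo i q)) (binaryRow-pos m (u i) i (u≤1 i) q)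
    ... | no q = subst (λ j → 1 ≤ at l j) (sym (≤-antisym (≤-pred lt) (≮⇒≥ q))) (≤-reflexive (sym am))
    ℓeq : ℓ ≡ suc m
    ℓeq = length-strip-firstZero l (suc m) Dl pos at-m1
    tm : term (suc m) m ≡ true
    tm = trans (cong (λ a → (1 ≤ᵇ a) ∧ ((a + m ≡ᵇ suc m) ∨ (a + m ≡ᵇ suc (suc m)))) am) (cong (_∨ (suc m ≡ᵇ suc (suc m))) (≡ᵇ-refl m))
    pt : ∀ v → v ≤ 1 → ((suc m ∸ v ≡ᵇ suc m) ∨ (suc m ∸ v ≡ᵇ suc (suc m))) ≡ (v ≡ᵇ 0)
    pt zero _ = cong (_∨ (suc m ≡ᵇ suc (suc m))) (≡ᵇ-refl m)
    pt (suc zero) _ = cong₂ _∨_ (≡ᵇ-false m (suc m) ≤-refl) (≡ᵇ-false m (suc (suc m)) (n≤1+n (suc m)))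
    pt (suc (suc _)) (s≤s ())
    cz : countBelow (λ i → u i ≡ᵇ 0) m ≡ zeros rest
    cz = trans (cong (countBelow (λ i → u i ≡ᵇ 0)) (sym (length-reverse rest))) (trans (count-zeros (reverse rest)) (zeros-rev rest))

  -- y = 1: ℓ = m; all first m rows are counted.
  colY1 : y ≡ 1 → firstColCount l ≡ m
  colY1 refl = begin
      firstColCount l
    ≡⟨ firstColCount≡ ⟩
      countBelow (term ℓ) (suc (suc m))
    ≡⟨ cong (λ L → countBelow (term L) (suc (suc m))) ℓeq ⟩
      countBelow (term m) (suc (suc m))
    ≡⟨ count-split m ⟩
      (countBelow (term m) m + ind (term m m)) + ind (term m (suc m))
    ≡⟨ cong₂ (λ a b → (countBelow (term m) m + ind a) + ind b) (term-zero m m am) (term-zero m (suc m) at-m1) ⟩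
      (countBelow (term m) m + 0) + 0
    ≡⟨ cong (λ k → (k + 0) + 0) (trans (countBelow-cong m (λ i lt → trans (term-lo m i lt) (pt (u i) (u≤1 i)))) (countBelow-true m)) ⟩
      (m + 0) + 0
    ≡⟨ trans (+-identityʳ _) (+-identityʳ m) ⟩
      m ∎
    where
    open ≡-Reasoning
    ℓ = length (strip l)
    am : at l m ≡ 0
    am = trans at-m (n∸n≡0 (suc m))
    ℓeq : ℓ ≡ m
    ℓeq = length-strip-firstZero l m Dl (λ i q → subst (1 ≤_) (sym (at-lo i q)) (binaryRow-pos m (u i) i (u≤1 i) q)) am
    pt : ∀ v → v ≤ 1 → ((suc m ∸ v ≡ᵇ m) ∨ (suc m ∸ v ≡ᵇ suc m)) ≡ true
    pt zero _ = trans (cong (_∨ (suc m ≡ᵇ suc m)) (trans (≡ᵇ-sym (suc m) m) (≡ᵇ-false m (suc m) ≤-refl))) (≡ᵇ-refl m)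
    pt (suc zero) _ = cong (_∨ (m ≡ᵇ suc m)) (≡ᵇ-refl m)
    pt (suc (suc _)) (s≤s ())

-- dinv(dyckPath v) = weight of v without its first letter: peel the first
-- column (which turns dyckPath v into dyckPath of the tail) and count it.
dinv-dyckPath : ∀ v → Binary v → dinv (dyckPath v) ≡ weight (drop 1 v)
dinv-dyckPath [] _ = refl
dinv-dyckPath (x ∷ w) (hx , bw) = begin
    dinv (fromRows R)
  ≡⟨ dinv-fromRows R ⟩
    dinvΣ (shift 0 R)
  ≡⟨ dinv-peelColumn (shift 0 R) DR ⟩
    firstColCount (shift 0 R) + dinvΣ (map pred (shift 0 R))
  ≡⟨ cong (firstColCount (shift 0 R) +_) tail-dinv ⟩
    firstColCount (shift 0 R) + weight (drop 1 w)
  ≡⟨ column-count w bw refl ⟩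
    weight w ∎
  where
  open ≡-Reasoning
  m' = length w
  R = map (suc m' ∸_) (reverse (x ∷ w))
  DR : Desc (shift 0 R)
  DR = Desc-shift 0 R (Reach-binary (suc m') (reverse (x ∷ w)) (Binary-reverse (x ∷ w) (hx , bw)))
  B = map (m' ∸_) (reverse w)
  lenB : length B ≡ m'
  lenB = trans (length-map (m' ∸_) (reverse w)) (length-reverse w)
  tail-dinv : dinvΣ (map pred (shift 0 R)) ≡ weight (drop 1 w)
  tail-dinv = begin
      dinvΣ (map pred (shift 0 R))
    ≡⟨ cong dinvΣ (shift-map-pred 0 R) ⟩
      dinvΣ (shift 0 (map pred R))
    ≡⟨ cong (λ L → dinvΣ (shift 0 L)) (trans (map-pred-∸ m' (reverse (x ∷ w))) (trans (cong (map (m' ∸_)) (unfold-reverse x w)) (map-++ (m' ∸_) (reverse w) (x ∷ [])))) ⟩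
      dinvΣ (shift 0 (B ++ ((m' ∸ x) ∷ [])))
    ≡⟨ sym (dinv-fromRows (B ++ ((m' ∸ x) ∷ []))) ⟩
      dinv (fromRows (B ++ ((m' ∸ x) ∷ [])))
    ≡⟨ cong dinv (fromRows-snoc-short B (m' ∸ x) (≤-trans (m∸n≤m m' x) (≤-trans (≤-reflexive (sym lenB)) (n≤1+n _)))) ⟩
      dinv (dyckPath w)
    ≡⟨ dinv-dyckPath w bw ⟩
      weight (drop 1 w) ∎
  column-count : ∀ w' → Binary w' → w' ≡ w → firstColCount (shift 0 R) + weight (drop 1 w) ≡ weight w
  column-count [] _ refl = cong (λ k → firstColCount (k ∷ []) + 0) (lem x)
    where
    lem : ∀ x → (1 ∸ x) ∸ 1 ≡ 0
    lem zero = refl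
    lem (suc x) = cong (_∸ 1) (0∸n≡0 x)
  column-count (zero ∷ rest) (_ , br) refl = cong (_+ weight rest) (trans (cong firstColCount (cong (shift 0) (FirstColumn.R≡ x 0 rest hx z≤n br))) (FirstColumn.colY0 x 0 rest hx z≤n br refl))
  column-count (suc zero ∷ rest) (_ , br) refl = cong (_+ weight rest) (trans (cong firstColCount (cong (shift 0) (FirstColumn.R≡ x 1 rest hx ≤-refl br))) (FirstColumn.colY1 x 1 rest hx ≤-refl br refl))
  column-count (suc (suc _) ∷ rest) (s≤s () , _) refl

-- The Dyck vector of γ_μ as a block word.  γvec μ = (0, blocksUpTo μ μ₁)
-- where block j is 0 followed by e_j ones.  Reading μ from its smallest part,
-- this is blockWord μ: each part a (after the part b below it) contributes
-- a - b zeros and then a one.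

mult-cons : ∀ a r j → mult (a ∷ r) j ≡ ind (a ≡ᵇ j) + mult r j
mult-cons a r j with a ≡ᵇ j
... | true = refl
... | false = refl

mult-zero : ∀ r j → (∀ i → at r i < j) → mult r j ≡ 0
mult-zero [] j h = refl
mult-zero (x ∷ r) j h = trans (mult-cons x r j) (cong₂ _+_ (cong ind (≡ᵇ-false x j (h 0))) (mult-zero r j (λ i → h (suc i))))

mult-ne : ∀ a r j → j < a → mult (a ∷ r) j ≡ mult r j
mult-ne a r j lt = trans (mult-cons a r j) (cong (λ b → ind b + mult r j) (trans (≡ᵇ-sym a j) (≡ᵇ-false j a lt)))

mult-eq : ∀ a r → mult (a ∷ r) a ≡ suc (mult r a)
mult-eq a r = trans (mult-cons a r a) (cong (λ b → ind b + mult r a) (≡ᵇ-refl a))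

blocksUpTo : List ℕ → ℕ → List ℕ
blocksUpTo μ zero = []
blocksUpTo μ (suc n) = blocksUpTo μ n ++ (0 ∷ replicate (mult μ (suc n)) 1)

replicate-snoc : ∀ n (x : ℕ) → replicate n x ++ (x ∷ []) ≡ replicate (suc n) x
replicate-snoc zero x = refl
replicate-snoc (suc n) x = cong (x ∷_) (replicate-snoc n x)

blocksUpTo-cong : ∀ μ μ' n → (∀ j → j ≤ n → mult μ (suc j) ≡ mult μ' (suc j)) → blocksUpTo μ (suc n) ≡ blocksUpTo μ' (suc n)
blocksUpTo-cong μ μ' zero h = cong (λ k → 0 ∷ replicate k 1) (h 0 z≤n)
blocksUpTo-cong μ μ' (suc n) h = cong₂ _++_ (blocksUpTo-cong μ μ' n (λ j lt → h j (≤-trans lt (n≤1+n n)))) (cong (λ k → 0 ∷ replicate k 1) (h (suc n) ≤-refl))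

blocksUpTo-pad : ∀ μ b d → (∀ j → b < j → mult μ j ≡ 0) → blocksUpTo μ (b + d) ≡ blocksUpTo μ b ++ replicate d 0
blocksUpTo-pad μ b zero h = trans (cong (blocksUpTo μ) (+-identityʳ b)) (sym (++-identityʳ (blocksUpTo μ b)))
blocksUpTo-pad μ b (suc d) h = begin
    blocksUpTo μ (b + suc d)
  ≡⟨ cong (blocksUpTo μ) (+-suc b d) ⟩
    blocksUpTo μ (b + d) ++ (0 ∷ replicate (mult μ (suc (b + d))) 1)
  ≡⟨ cong₂ (λ X k → X ++ (0 ∷ replicate k 1)) (blocksUpTo-pad μ b d h) (h (suc (b + d)) (s≤s (m≤m+n b d))) ⟩
    (blocksUpTo μ b ++ replicate d 0) ++ (0 ∷ [])
  ≡⟨ ++-assoc (blocksUpTo μ b) (replicate d 0) (0 ∷ []) ⟩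
    blocksUpTo μ b ++ (replicate d 0 ++ (0 ∷ []))
  ≡⟨ cong (blocksUpTo μ b ++_) (replicate-snoc d 0) ⟩
    blocksUpTo μ b ++ replicate (suc d) 0 ∎
  where open ≡-Reasoning

blocksUpTo-drop : ∀ a rest n → n < a → blocksUpTo (a ∷ rest) n ≡ blocksUpTo rest n
blocksUpTo-drop a rest zero _ = refl
blocksUpTo-drop a rest (suc n) h = blocksUpTo-cong (a ∷ rest) rest n (λ j lt → mult-ne a rest (suc j) (≤-<-trans (s≤s lt) h))

blockWord : List ℕ → List ℕ
blockWord [] = []
blockWord (a ∷ rest) = blockWord rest ++ (replicate (a ∸ at rest 0) 0 ++ (1 ∷ []))

blocksUpTo-blockWord : ∀ μ → Desc μ → Pos μ → blocksUpTo μ (at μ 0) ≡ blockWord μ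
blocksUpTo-blockWord [] _ _ = refl
blocksUpTo-blockWord (suc a' ∷ rest) d (_ , prest) = begin
    blocksUpTo (a ∷ rest) a' ++ (0 ∷ replicate (mult (a ∷ rest) a) 1)
  ≡⟨ cong₂ (λ X k → X ++ (0 ∷ replicate k 1)) e1 (mult-eq a rest) ⟩
    blocksUpTo rest a' ++ (0 ∷ replicate (suc (mult rest a)) 1)
  ≡⟨ cong (λ X → blocksUpTo rest a' ++ (0 ∷ X)) (sym (replicate-snoc (mult rest a) 1)) ⟩
    blocksUpTo rest a' ++ ((0 ∷ replicate (mult rest a) 1) ++ (1 ∷ []))
  ≡⟨ sym (++-assoc (blocksUpTo rest a') (0 ∷ replicate (mult rest a) 1) (1 ∷ [])) ⟩
    blocksUpTo rest a ++ (1 ∷ [])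
  ≡⟨ cong (_++ (1 ∷ [])) e2 ⟩
    (blocksUpTo rest b ++ replicate (a ∸ b) 0) ++ (1 ∷ [])
  ≡⟨ ++-assoc (blocksUpTo rest b) (replicate (a ∸ b) 0) (1 ∷ []) ⟩
    blocksUpTo rest b ++ (replicate (a ∸ b) 0 ++ (1 ∷ []))
  ≡⟨ cong (_++ (replicate (a ∸ b) 0 ++ (1 ∷ []))) (blocksUpTo-blockWord rest (Desc-tail a rest d) prest) ⟩
    blockWord (a ∷ rest) ∎
  where
  open ≡-Reasoning
  a = suc a'
  b = at rest 0
  e1 : blocksUpTo (a ∷ rest) a' ≡ blocksUpTo rest a'
  e1 = blocksUpTo-drop a rest a' ≤-refl
  b≤a : b ≤ a
  b≤a = Desc-at a rest d 0
  e2 : blocksUpTo rest a ≡ blocksUpTo rest b ++ replicate (a ∸ b) 0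
  e2 = trans (cong (blocksUpTo rest) (sym (m+[n∸m]≡n b≤a)))
    (blocksUpTo-pad rest b (a ∸ b) (λ j lt → mult-zero rest j (λ i → ≤-<-trans (Desc-mono rest (Desc-tail a rest d) 0 i z≤n) lt)))

γvec-blocksUpTo : ∀ μ n → blocksUpTo μ (suc n) ≡ 0 ∷ (replicate (mult μ 1) 1 ++ concatMap (λ j → 0 ∷ replicate (mult μ j) 1) (map (2 +_) (upTo n)))
γvec-blocksUpTo μ zero = cong (0 ∷_) (sym (++-identityʳ (replicate (mult μ 1) 1)))
γvec-blocksUpTo μ (suc n) = begin
    blocksUpTo μ (suc n) ++ f (suc (suc n))
  ≡⟨ cong (_++ f (suc (suc n))) (γvec-blocksUpTo μ n) ⟩
    (0 ∷ (rp ++ CM (upTo n))) ++ f (2 + n)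
  ≡⟨ cong (0 ∷_) (++-assoc rp (CM (upTo n)) (f (2 + n))) ⟩
    0 ∷ (rp ++ (CM (upTo n) ++ f (2 + n)))
  ≡⟨ cong (λ X → 0 ∷ (rp ++ X)) e ⟩
    0 ∷ (rp ++ CM (upTo (suc n))) ∎
  where
  open ≡-Reasoning
  f : ℕ → List ℕ
  f j = 0 ∷ replicate (mult μ j) 1
  rp = replicate (mult μ 1) 1
  CM : List ℕ → List ℕ
  CM l = concatMap f (map (2 +_) l)
  e : CM (upTo n) ++ f (2 + n) ≡ CM (upTo (suc n))
  e = begin
      CM (upTo n) ++ f (2 + n)
    ≡⟨ cong (CM (upTo n) ++_) (sym (++-identityʳ (f (2 + n)))) ⟩
      CM (upTo n) ++ CM (n ∷ [])
    ≡⟨ sym (concatMap-++ f (map (2 +_) (upTo n)) (map (2 +_) (n ∷ []))) ⟩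
      concatMap f (map (2 +_) (upTo n) ++ map (2 +_) (n ∷ []))
    ≡⟨ cong (concatMap f) (sym (map-++ (2 +_) (upTo n) (n ∷ []))) ⟩
      CM (upTo n ∷ʳ n)
    ≡⟨ cong CM (applyUpTo-∷ʳ (λ i → i) n) ⟩
      CM (upTo (suc n)) ∎

γvec≡blockWord : ∀ μ → Desc μ → Pos μ → 1 ≤ at μ 0 → γvec μ ≡ 0 ∷ blockWord μ
γvec≡blockWord μ d p h = cong (0 ∷_) (trans (sym (γvec-blocksUpTo μ (at μ 0 ∸ 1))) (trans (cong (blocksUpTo μ) (lem (at μ 0) h)) (blocksUpTo-blockWord μ d p)))
  where
  lem : ∀ a → 1 ≤ a → suc (a ∸ 1) ≡ a
  lem (suc a) _ = refl

zeros-run : ∀ c → zeros (replicate c 0 ++ (1 ∷ [])) ≡ c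
zeros-run zero = refl
zeros-run (suc c) = cong suc (zeros-run c)

ones : List ℕ → ℕ
ones [] = 0
ones (zero ∷ w) = ones w
ones (suc _ ∷ w) = suc (ones w)

ones-++ : ∀ A B → ones (A ++ B) ≡ ones A + ones B
ones-++ [] B = refl
ones-++ (zero ∷ A) B = ones-++ A B
ones-++ (suc _ ∷ A) B = cong suc (ones-++ A B)

ones-run : ∀ c → ones (replicate c 0 ++ (1 ∷ [])) ≡ 1
ones-run zero = refl
ones-run (suc c) = ones-run c

length-run : ∀ c → length (replicate c 0 ++ (1 ∷ [])) ≡ suc c
length-run zero = refl
length-run (suc c) = cong suc (length-run c)

Binary-run : ∀ c → Binary (replicate c 0 ++ (1 ∷ []))
Binary-run zero = ≤-refl , tt
Binary-run (suc c) = z≤n , Binary-run c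

length-blockWord : ∀ μ → Desc μ → length (blockWord μ) ≡ at μ 0 + length μ
length-blockWord [] _ = refl
length-blockWord (a ∷ rest) d = begin
    length (blockWord rest ++ (replicate (a ∸ b) 0 ++ (1 ∷ [])))
  ≡⟨ length-++ (blockWord rest) ⟩
    length (blockWord rest) + length (replicate (a ∸ b) 0 ++ (1 ∷ []))
  ≡⟨ cong₂ _+_ (length-blockWord rest (Desc-tail a rest d)) (length-run (a ∸ b)) ⟩
    (b + length rest) + suc (a ∸ b)
  ≡⟨ arith ⟩
    a + suc (length rest) ∎
  where
  open ≡-Reasoning
  b = at rest 0
  arith : (b + length rest) + suc (a ∸ b) ≡ a + suc (length rest)
  arith = begin
      (b + length rest) + suc (a ∸ b) ≡⟨ +-suc (b + length rest) (a ∸ b) ⟩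
      suc ((b + length rest) + (a ∸ b)) ≡⟨ cong suc (trans (+-assoc b _ _) (trans (cong (b +_) (+-comm (length rest) (a ∸ b))) (sym (+-assoc b (a ∸ b) _)))) ⟩
      suc ((b + (a ∸ b)) + length rest) ≡⟨ cong (λ x → suc (x + length rest)) (m+[n∸m]≡n (Desc-at a rest d 0)) ⟩
      suc (a + length rest) ≡⟨ sym (+-suc a (length rest)) ⟩
      a + suc (length rest) ∎

zeros-blockWord : ∀ μ → Desc μ → zeros (blockWord μ) ≡ at μ 0
zeros-blockWord [] _ = refl
zeros-blockWord (a ∷ rest) d = trans (zeros-++ (blockWord rest) _) (trans (cong₂ _+_ (zeros-blockWord rest (Desc-tail a rest d)) (zeros-run (a ∸ at rest 0)))
  (m+[n∸m]≡n (Desc-at a rest d 0)))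

ones-blockWord : ∀ μ → ones (blockWord μ) ≡ length μ
ones-blockWord [] = refl
ones-blockWord (a ∷ rest) = trans (ones-++ (blockWord rest) _) (trans (cong₂ _+_ (ones-blockWord rest) (ones-run (a ∸ at rest 0))) (+-comm (length rest) 1))

Binary-blockWord : ∀ μ → Binary (blockWord μ)
Binary-blockWord [] = tt
Binary-blockWord (a ∷ rest) = Binary-++ (blockWord rest) _ (Binary-blockWord rest) (Binary-run (a ∸ at rest 0))

-- weight of a concatenation: cross terms pair 0s with later 0s and 1s with later letters.
weight-++ : ∀ A B → weight (A ++ B) ≡ weight A + weight B + zeros A * zeros B + ones A * length B
weight-++ [] B = sym (trans (+-identityʳ _) (+-identityʳ (weight B)))
weight-++ (zero ∷ A) B = begin
    suc (zeros (A ++ B)) + weight (A ++ B)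
  ≡⟨ cong₂ (λ x y → suc x + y) (zeros-++ A B) (weight-++ A B) ⟩
    suc (zeros A + zeros B) + (weight A + weight B + zeros A * zeros B + ones A * length B)
  ≡⟨ ar (zeros A) (zeros B) (weight A) (weight B) (ones A) (length B) ⟩
    suc (zeros A) + weight A + weight B + suc (zeros A) * zeros B + ones A * length B ∎
  where
  open ≡-Reasoning
  ar : ∀ za zb fa fb na lb → suc (za + zb) + (fa + fb + za * zb + na * lb) ≡ suc za + fa + fb + suc za * zb + na * lb
  ar = solve-∀
weight-++ (suc x ∷ A) B = begin
    length (A ++ B) + weight (A ++ B)
  ≡⟨ cong₂ _+_ (length-++ A) (weight-++ A B) ⟩
    (length A + length B) + (weight A + weight B + zeros A * zeros B + ones A * length B)
  ≡⟨ ar (zeros A) (zeros B) (weight A) (weight B) (ones A) (length A) (length B) ⟩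
    length A + weight A + weight B + zeros A * zeros B + suc (ones A) * length B ∎
  where
  open ≡-Reasoning
  ar : ∀ za zb fa fb na la lb → (la + lb) + (fa + fb + za * zb + na * lb) ≡ la + fa + fb + za * zb + suc na * lb
  ar = solve-∀

tri : ℕ → ℕ
tri n = n C 2

tri-suc : ∀ n → tri (suc n) ≡ n + tri n
tri-suc n = trans (sym (nCk+nC[k+1]≡[n+1]C[k+1] n 1)) (cong (_+ tri n) (nC1≡n n))

tri-add : ∀ x y → tri (x + y) ≡ tri x + tri y + x * y
tri-add zero y = sym (trans (+-identityʳ _) refl)
tri-add (suc x) y = begin
    tri (suc (x + y))
  ≡⟨ tri-suc (x + y) ⟩
    (x + y) + tri (x + y)
  ≡⟨ cong ((x + y) +_) (tri-add x y) ⟩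
    (x + y) + (tri x + tri y + x * y)
  ≡⟨ ar x y (tri x) (tri y) ⟩
    (x + tri x) + tri y + suc x * y
  ≡⟨ cong (λ k → k + tri y + suc x * y) (sym (tri-suc x)) ⟩
    tri (suc x) + tri y + suc x * y ∎
  where
  open ≡-Reasoning
  ar : ∀ x y tx ty → (x + y) + (tx + ty + x * y) ≡ (x + tx) + ty + suc x * y
  ar = solve-∀

weight-run : ∀ c → weight (replicate c 0 ++ (1 ∷ [])) ≡ tri (suc c)
weight-run zero = refl
weight-run (suc c) = trans (cong₂ (λ x y → suc x + y) (zeros-run c) (weight-run c)) (sym (tri-suc (suc c)))

weight-blockWord : ∀ μ → Desc μ → weight (blockWord μ) + sum μ + length μ ≡ tri (suc (at μ 0 + length μ))
weight-blockWord [] _ = refl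
weight-blockWord (a ∷ rest) d = begin
    weight (blockWord rest ++ (replicate c 0 ++ (1 ∷ []))) + (a + sum rest) + suc ℓ'
  ≡⟨ cong (λ X → X + (a + sum rest) + suc ℓ') (weight-++ (blockWord rest) _) ⟩
    (weight (blockWord rest) + weight (replicate c 0 ++ (1 ∷ [])) + zeros (blockWord rest) * zeros (replicate c 0 ++ (1 ∷ [])) + ones (blockWord rest) * length (replicate c 0 ++ (1 ∷ []))) + (a + sum rest) + suc ℓ'
  ≡⟨ cong₂ (λ X Y → (weight (blockWord rest) + X + Y + ones (blockWord rest) * length (replicate c 0 ++ (1 ∷ []))) + (a + sum rest) + suc ℓ')
       (weight-run c) (cong₂ _*_ (zeros-blockWord rest dr) (zeros-run c)) ⟩
    (weight (blockWord rest) + tri (suc c) + b * c + ones (blockWord rest) * length (replicate c 0 ++ (1 ∷ []))) + (a + sum rest) + suc ℓ'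
  ≡⟨ cong (λ Y → (weight (blockWord rest) + tri (suc c) + b * c + Y) + (a + sum rest) + suc ℓ')
       (cong₂ _*_ (ones-blockWord rest) (length-run c)) ⟩
    (weight (blockWord rest) + tri (suc c) + b * c + ℓ' * suc c) + (a + sum rest) + suc ℓ'
  ≡⟨ cong (λ x → (weight (blockWord rest) + tri (suc c) + b * c + ℓ' * suc c) + (x + sum rest) + suc ℓ') (sym a≡) ⟩
    (weight (blockWord rest) + tri (suc c) + b * c + ℓ' * suc c) + ((b + c) + sum rest) + suc ℓ'
  ≡⟨ ar (weight (blockWord rest)) (sum rest) ℓ' b c (tri (suc c)) ⟩
    (weight (blockWord rest) + sum rest + ℓ') + tri (suc c) + suc (b + ℓ') * suc c
  ≡⟨ cong (λ X → X + tri (suc c) + suc (b + ℓ') * suc c) (weight-blockWord rest dr) ⟩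
    tri (suc (b + ℓ')) + tri (suc c) + suc (b + ℓ') * suc c
  ≡⟨ sym (tri-add (suc (b + ℓ')) (suc c)) ⟩
    tri (suc (b + ℓ') + suc c)
  ≡⟨ cong tri (ar2 b ℓ' c) ⟩
    tri (suc ((b + c) + suc ℓ'))
  ≡⟨ cong (λ x → tri (suc (x + suc ℓ'))) a≡ ⟩
    tri (suc (a + suc ℓ')) ∎
  where
  open ≡-Reasoning
  dr = Desc-tail a rest d
  b = at rest 0
  c = a ∸ b
  ℓ' = length rest
  a≡ : b + c ≡ a
  a≡ = m+[n∸m]≡n (Desc-at a rest d 0)
  ar : ∀ F S l b c t → (F + t + b * c + l * suc c) + ((b + c) + S) + suc l ≡ (F + S + l) + t + suc (b + l) * suc c
  ar = solve-∀
  ar2 : ∀ b l c → suc (b + l) + suc c ≡ suc ((b + c) + suc l)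
  ar2 = solve-∀

zipWith-shift : ∀ N k (f : ℕ → ℕ) l → (∀ i → f i ≡ k + i) → zipWith (λ i x → (N ∸ suc i) ∸ x) (applyUpTo f (length l)) l ≡ shift k (map (N ∸_) l)
zipWith-shift N k f [] h = refl
zipWith-shift N k f (x ∷ l) h = cong₂ _∷_ hd (zipWith-shift N (suc k) (f ∘ suc) l (λ i → trans (h (suc i)) (+-suc k i)))
  where
  hd : (N ∸ suc (f 0)) ∸ x ≡ (N ∸ x) ∸ suc k
  hd = begin
      (N ∸ suc (f 0)) ∸ x ≡⟨ cong (λ y → (N ∸ suc y) ∸ x) (trans (h 0) (+-identityʳ k)) ⟩
      (N ∸ suc k) ∸ x ≡⟨ ∸-+-assoc N (suc k) x ⟩
      N ∸ (suc k + x) ≡⟨ cong (N ∸_) (+-comm (suc k) x) ⟩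
      N ∸ (x + suc k) ≡⟨ sym (∸-+-assoc N x (suc k)) ⟩
      (N ∸ x) ∸ suc k ∎
    where open ≡-Reasoning

dp≡dyckPath : ∀ v → dp (length v) v ≡ dyckPath v
dp≡dyckPath v = cong strip (trans (cong (λ n → zipWith (λ i x → (length v ∸ suc i) ∸ x) (upTo n) (reverse v)) (sym (length-reverse v)))
                           (zipWith-shift (length v) 0 (λ i → i) (reverse v) (λ i → refl)))

countdown-suc : ∀ n → countdown 1 n ≡ map suc (countdown 0 n)
countdown-suc zero = refl
countdown-suc (suc n) = cong (suc n ∷_) (countdown-suc n)

countdown-snoc : ∀ n → countdown 0 (suc n) ≡ map suc (countdown 0 n) ++ (0 ∷ [])
countdown-snoc zero = refl
countdown-snoc (suc n) = cong (suc n ∷_) (countdown-snoc n)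

reverse-countdown : ∀ (g : List ℕ) → reverse g ≡ map (at g) (countdown 0 (length g))
reverse-countdown [] = refl
reverse-countdown (x ∷ g) = begin
    reverse (x ∷ g)
  ≡⟨ unfold-reverse x g ⟩
    reverse g ++ (x ∷ [])
  ≡⟨ cong (_++ (x ∷ [])) (reverse-countdown g) ⟩
    map (at g) (countdown 0 (length g)) ++ (x ∷ [])
  ≡⟨ cong (_++ (x ∷ [])) (map-∘ (countdown 0 (length g))) ⟩
    map (at (x ∷ g)) (map suc (countdown 0 (length g))) ++ map (at (x ∷ g)) (0 ∷ [])
  ≡⟨ sym (map-++ (at (x ∷ g)) (map suc (countdown 0 (length g))) (0 ∷ [])) ⟩
    map (at (x ∷ g)) (map suc (countdown 0 (length g)) ++ (0 ∷ []))
  ≡⟨ cong (map (at (x ∷ g))) (sym (countdown-snoc (length g))) ⟩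
    map (at (x ∷ g)) (countdown 0 (suc (length g))) ∎
  where open ≡-Reasoning

dyckPath-rows : ∀ g → dyckPath g ≡ fromRows (map (λ j → length g ∸ at g (pred j)) (countdown 1 (length g)))
dyckPath-rows g = cong fromRows (begin
    map (length g ∸_) (reverse g)
  ≡⟨ cong (map (length g ∸_)) (reverse-countdown g) ⟩
    map (length g ∸_) (map (at g) (countdown 0 (length g)))
  ≡⟨ sym (map-∘ (countdown 0 (length g))) ⟩
    map (λ j → length g ∸ at g j) (countdown 0 (length g))
  ≡⟨ map-∘ (countdown 0 (length g)) ⟩
    map (λ j → length g ∸ at g (pred j)) (map suc (countdown 0 (length g)))
  ≡⟨ cong (map (λ j → length g ∸ at g (pred j))) (sym (countdown-suc (length g))) ⟩
    map (λ j → length g ∸ at g (pred j)) (countdown 1 (length g)) ∎)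
  where open ≡-Reasoning

record Start (μ : List ℕ) : Set where
  field
    G : ℕ → ℕ
    G≤1 : ∀ j → G j ≤ 1
    G2 : G 2 ≡ 0
    Gbig : ∀ j → suc (suc (ζ μ)) ≤ j → G j ≡ 0
    γ≡rows₀ : γ_ μ ≡ fromRows (Orbit.rows₀ (ζ μ) G G≤1 G2 Gbig)
    dinv₀ : dinv (γ_ μ) + size μ + len μ ≡ suc (ζ μ) C 2

-- For μ ≠ (0), G j = g_{j-1} for the Dyck vector g = γvec μ = (0, blockWord μ)
-- of length ζ+1; the dinv value comes from dinv-dyckPath and weight-blockWord.
start : ∀ μ → IsPartition μ → Start μ
start [] _ = record { G = λ _ → 0 ; G≤1 = λ _ → z≤n ; G2 = refl ; Gbig = λ _ _ → refl ; γ≡rows₀ = refl ; dinv₀ = refl }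
start μ@(a ∷ rest) isPart = record { G = G ; G≤1 = G≤1 ; G2 = refl ; Gbig = Gbig ; γ≡rows₀ = γ≡rows ; dinv₀ = dinv-γ }
  where
  d = proj₁ (IsPartition⇒ μ isPart)
  p = proj₂ (IsPartition⇒ μ isPart)
  g = γvec μ
  g≡ : g ≡ 0 ∷ blockWord μ
  g≡ = γvec≡blockWord μ d p (proj₁ p)
  lenμ : len μ ≡ length μ
  lenμ = cong length (Pos-strip μ p)
  length-g : length g ≡ suc (ζ μ)
  length-g = trans (cong length g≡) (cong suc (trans (length-blockWord μ d) (cong (a +_) (sym lenμ))))
  binary-g : Binary g
  binary-g = subst Binary (sym g≡) (z≤n , Binary-blockWord μ)
  G : ℕ → ℕ
  G j = at g (pred j)
  G≤1 : ∀ j → G j ≤ 1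
  G≤1 j = Binary-at g binary-g (pred j)
  Gbig : ∀ j → suc (suc (ζ μ)) ≤ j → G j ≡ 0
  Gbig j hj = at-beyond g (pred j) (subst (_≤ pred j) (sym length-g) (pred-mono-≤ hj))
  γ≡dyckPath : γ_ μ ≡ dyckPath g
  γ≡dyckPath = trans (cong (λ n → dp n g) (sym length-g)) (dp≡dyckPath g)
  γ≡rows : γ_ μ ≡ fromRows (Orbit.rows₀ (ζ μ) G G≤1 refl Gbig)
  γ≡rows = trans γ≡dyckPath (trans (dyckPath-rows g) (cong (λ n → fromRows (map (λ j → n ∸ at g (pred j)) (countdown 1 n))) length-g))
  dinv-γ : dinv (γ_ μ) + size μ + len μ ≡ suc (ζ μ) C 2
  dinv-γ = begin
      dinv (γ_ μ) + size μ + len μ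
    ≡⟨ cong₂ (λ X Y → X + size μ + Y) (trans (cong dinv γ≡dyckPath) (trans (dinv-dyckPath g binary-g) (cong (weight ∘ drop 1) g≡))) lenμ ⟩
      weight (blockWord μ) + sum μ + length μ
    ≡⟨ weight-blockWord μ d ⟩
      suc (a + length μ) C 2
    ≡⟨ cong (λ X → suc (a + X) C 2) (sym lenμ) ⟩
      suc (ζ μ) C 2 ∎
    where open ≡-Reasoning

open import Data.Integer using (ℤ; +_; _-_)
import Data.Integer.Properties as ℤ
open import Data.Integer.Tactic.RingSolver using () renaming (solve-∀ to ℤ-solve-∀)

ℤ-rearrange : ∀ d s l m → + (m + d) ≡ + (d + s + l) - + s - + l Data.Integer.+ + m
ℤ-rearrange d s l m = begin
    + (m + d)
  ≡⟨ ℤ.pos-+ m d ⟩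
    + m Data.Integer.+ + d
  ≡⟨ ring (+ d) (+ s) (+ l) (+ m) ⟩
    (+ d Data.Integer.+ + s Data.Integer.+ + l) - + s - + l Data.Integer.+ + m
  ≡⟨ cong (λ X → X - + s - + l Data.Integer.+ + m) (sym (trans (ℤ.pos-+ (d + s) l) (cong (Data.Integer._+ + l) (ℤ.pos-+ d s)))) ⟩
    + (d + s + l) - + s - + l Data.Integer.+ + m ∎
  where
  open ≡-Reasoning
  ring : ∀ (d s l m : ℤ) → m Data.Integer.+ d ≡ (d Data.Integer.+ s Data.Integer.+ l) - s - l Data.Integer.+ m
  ring = ℤ-solve-∀

module Consequences (μ : List ℕ) (S : Start μ) where
  open Start S
  open Orbit (ζ μ) G G≤1 G2 Gbig

  -- (1) ν^m(γ_μ) is defined: m = 0, or m-1 = blockStart t + p with p in block t.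
  defined : ∀ m → Σ (List ℕ) λ γ → νIter m (γ_ μ) ≡ just γ
  defined zero = γ_ μ , refl
  defined (suc k) with blockDecomposition k
  ... | t , p , hp , e = fromRows (state t p) , trans (cong₂ (λ a b → νIter (suc a) b) e γ≡rows₀) (orbit t p hp)

  dinv-formula : (m : ℕ) → Σ (List ℕ) λ γ → (νIter m (γ_ μ) ≡ just γ)
      × ((+ dinv γ) ≡ (+ ((suc (ζ μ)) C 2)) - (+ size μ) - (+ len μ) Data.Integer.+ (+ m))
  dinv-formula m with defined m
  ... | γ , eq = γ , eq , trans (cong +_ (proj₂ (dinv-νIter (γ_ μ) (proj₁ γ-partition) (proj₂ γ-partition) m γ eq)))
                              (trans (ℤ-rearrange (dinv (γ_ μ)) (size μ) (len μ) m) (cong (λ X → + X - + size μ - + len μ Data.Integer.+ + m) dinv₀))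
    where
    γ-partition : Desc (γ_ μ) × Pos (γ_ μ)
    γ-partition = subst (λ X → Desc X × Pos X) (sym γ≡rows₀) (Desc-strip (shift 0 rows₀) Desc-rows₀)

  Δ-formula : (t r : ℕ) → r < suc (ζ μ) + t →
      Σ (List ℕ) λ γ → (νIter (suc (blockStart (ζ μ) t + r)) (γ_ μ) ≡ just γ)
        × IsΔ γ (ζ μ + 2 + t)
  Δ-formula t r lt = fromRows (state t r) , trans (cong (νIter (suc (blockStart (ζ μ) t + r))) γ≡rows₀) (orbit t r (≤-pred lt)) , isΔ t r (≤-pred lt)

lemma4p9 : (μ : List ℕ) → IsPartition μ →
    ((m : ℕ) → Σ (List ℕ) λ γ → (νIter m (γ_ μ) ≡ just γ)
      × ((+ dinv γ) ≡ (+ ((suc (ζ μ)) C 2)) - (+ size μ) - (+ len μ) Data.Integer.+ (+ m)))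
    × ((t r : ℕ) → r < suc (ζ μ) + t →
      Σ (List ℕ) λ γ → (νIter (suc (blockStart (ζ μ) t + r)) (γ_ μ) ≡ just γ)
        × IsΔ γ (ζ μ + 2 + t))
lemma4p9 μ isPart = dinv-formula , Δ-formula
  where open Consequences μ (start μ isPart)
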